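{- Fix integers $n,k,i$. There is a map $F_{n,k,i}:\mathrm{QSym}_n\to\mathrm{QSym}$ such that for every naturally labeled poset $P$ on $[n]$ which has a unique order ideal $I$ with $|I|=k$ and exactly $i$ maximal elements, $F_{n,k,i}(K_P(\mathbf{x}))=K_{P\setminus I}(\mathbf{x})$. In particular, $K_{P\setminus I}(\mathbf{x})$ is determined by $K_P(\mathbf{x})$.
   Context: A poset $(P,\preceq)$ on ground set $[n]$ is naturally labeled if $x\preceq y$ implies $x\le y$ as integers; the subposet $P\setminus I$ is given any natural labeling. For such $P$, $K_P(\mathbf{x})=\sum_{\sigma}\prod_{p\in P}x_{\sigma(p)}$, the sum over all maps $\sigma:P\to\mathbb{Z}^+$ with $\sigma(x)\le\sigma(y)$ whenever $x\preceq y$; $\mathrm{QSym}_n$ is the space of quasisymmetric functions homogeneous of degree $n$. An order ideal of $P$ is a subset $I$ such that $x\in I$ and $y\preceq x$ imply $y\in I$. -}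

module Defs where

open import Data.Bool using (Bool; true; false; _∧_; _∨_; not; if_then_else_)
open import Data.Nat using (ℕ; zero; suc; _≤ᵇ_; _≡ᵇ_; _≤_; _>_)
open import Data.Fin using (Fin; toℕ)
import Data.Fin as Fin
open import Data.List using (List; []; _∷_; length; map; concatMap; allFin; filter; zip; lookup)
open import Data.Nat.ListAction using (sum)
open import Data.Integer using (ℤ; +_)
open import Data.Product using (Σ; ∃; _×_; _,_; proj₁; proj₂)
open import Relation.Nullary using (¬_)
open import Relation.Nullary.Decidable using (⌊_⌋)
open import Relation.Binary.PropositionalEquality using (_≡_)

-- Formal power series in x₁, x₂, … with integer coefficients.
-- A monomial x₁^{a₁} ⋯ x_m^{a_m} is encoded by its exponent list
-- (a₁ , … , a_m); a series is its coefficient function.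

Monomial : Set
Monomial = List ℕ

Series : Set
Series = Monomial → ℤ

nonzeroPart : Monomial → List ℕ
nonzeroPart []            = []
nonzeroPart (zero  ∷ as)  = nonzeroPart as
nonzeroPart (suc a ∷ as)  = suc a ∷ nonzeroPart as

degree : Monomial → ℕ
degree = sum

-- quasisymmetric: coefficient of x_{j₁}^{c₁}⋯x_{j_l}^{c_l} (j₁<⋯<j_l)
-- depends only on (c₁,…,c_l). (This also makes trailing zeros irrelevant.)
IsQuasisym : Series → Set
IsQuasisym f = ∀ a b → nonzeroPart a ≡ nonzeroPart b → f a ≡ f b

HomogeneousOf : ℕ → Series → Set
HomogeneousOf n f = ∀ a → ¬ (degree a ≡ n) → f a ≡ + 0

QSymN : ℕ → Set
QSymN n = Σ Series (λ f → IsQuasisym f × HomogeneousOf n f)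

-- QSym : quasisymmetric series of bounded degree (finite sums of
-- homogeneous quasisymmetric functions)
QSym : Set
QSym = Σ Series (λ f → IsQuasisym f × ∃ (λ d → ∀ a → degree a > d → f a ≡ + 0))

all : {A : Set} → (A → Bool) → List A → Bool
all p []       = true
all p (x ∷ xs) = p x ∧ all p xs

record NatPoset (n : ℕ) : Set where
  field
    _≼_     : Fin n → Fin n → Bool
    refl≼   : ∀ x → (x ≼ x) ≡ true
    antisym : ∀ x y → (x ≼ y) ≡ true → (y ≼ x) ≡ true → x ≡ y
    trans≼  : ∀ x y z → (x ≼ y) ≡ true → (y ≼ z) ≡ true → (x ≼ z) ≡ true
    natural : ∀ x y → (x ≼ y) ≡ true → toℕ x ≤ toℕ y

open NatPoset public

Subset : ℕ → Set
Subset n = Fin n → Bool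

count : {A : Set} → (A → Bool) → List A → ℕ
count p []       = 0
count p (x ∷ xs) = if p x then suc (count p xs) else count p xs

size : ∀ {n} → Subset n → ℕ
size {n} S = count S (allFin n)

IsOrderIdeal : ∀ {n} → NatPoset n → Subset n → Set
IsOrderIdeal P I = ∀ x y → (_≼_ P y x) ≡ true → I x ≡ true → I y ≡ true

_≠ᶠ_ : ∀ {n} → Fin n → Fin n → Bool
x ≠ᶠ y = not ⌊ x Fin.≟ y ⌋

numMaximal : ∀ {n} → NatPoset n → Subset n → ℕ
numMaximal {n} P I =
  count (λ x → I x ∧ all (λ y → not (I y ∧ (y ≠ᶠ x) ∧ _≼_ P x y)) (allFin n)) (allFin n)

-- K_P for the subposet of P induced on a list X of elements:
-- coefficient of x₁^{a₁}⋯x_m^{a_m} = number of maps σ : X → {1..m}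
-- with σ(x) ≤ σ(y) whenever x ≼ y, and |σ⁻¹(j)| = a_j for all j.

allWords : (m L : ℕ) → List (List (Fin m))
allWords m zero    = [] ∷ []
allWords m (suc L) = concatMap (λ w → map (λ j → j ∷ w) (allFin m)) (allWords m L)

isPPartition : ∀ {n} → NatPoset n → (a : Monomial) →
               List (Fin n × Fin (length a)) → Bool
isPPartition P a g =
  all (λ p → all (λ q → not (_≼_ P (proj₁ p) (proj₁ q))
                        ∨ (toℕ (proj₂ p) ≤ᵇ toℕ (proj₂ q))) g) g
  ∧ all (λ j → count (λ q → ⌊ proj₂ q Fin.≟ j ⌋) g ≡ᵇ lookup a j)
        (allFin (length a))

K-on : ∀ {n} → NatPoset n → List (Fin n) → Series
K-on P X a =
  + count (λ w → isPPartition P a (zip X w)) (allWords (length a) (length X))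

K : ∀ {n} → NatPoset n → Series
K {n} P = K-on P (allFin n)

-- K_{P∖I}(x) : the induced subposet on the complement of I
-- (K is independent of the labeling, so no relabeling is needed)
K-minus : ∀ {n} → NatPoset n → Subset n → Series
K-minus {n} P I = K-on P (filter (λ x → not (I x) Data.Bool.≟ true) (allFin n))

module Submission where

-- Coefficients are computed combinatorially: the coefficient of x₁^c xᵃ in
-- K_X is the sum of K_{X∖D}(xᵃ) over the ideals D of X of size c
-- (K-first-variable).  Iterating this inside the signed recursion `sieve`
-- isolates the sets of j minimal elements (sieve-K); the needed cancellation
-- is an alternating sum over the sets of maximal elements of an ideal.  A
-- binomially weighted combination of sieves, `extract k i`, then yields the sum
-- of K_{X∖E} over the ideals E of size k with i maximal elements (extract-K),
-- using ∑_{S ⊆ M} (-1)^|S| C(|S|, i) = (-1)^i [|M| = i].  For the unique such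
-- ideal this sum has a single term (extract-unique-ideal), and extract only
-- reads the coefficients f (b ++ a), so it maps QSym_n to QSym.

open import Defs
open import Data.Nat using (ℕ)
open import Data.Product using (Σ; _×_; _,_; proj₁)
open import Relation.Binary.PropositionalEquality using (_≡_)

open import Algebra.Bundles using (CommutativeMonoid)
open import Data.Bool using (Bool; true; false; _∧_; _∨_; not; T)
import Data.Bool as Bool
open import Data.Bool.Properties
  using (∧-commutativeMonoid; ∧-assoc; ∧-zeroʳ; ∧-identityʳ; ∧-conicalˡ; ∧-conicalʳ;
         ∨-zeroʳ; ∨-identityʳ; not-¬; T-≡)
open import Data.Empty using (⊥)
open import Data.Fin using (Fin; zero; suc; toℕ; _≟_)
open import Data.Fin.Properties using (toℕ-injective)
open import Data.Integer using (ℤ; +_; _+_; _*_; -_; 0ℤ; 1ℤ)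
open import Data.Integer.Properties
  using (+-identityˡ; +-identityʳ; +-assoc; +-inverseʳ; *-identityˡ; *-identityʳ; *-zeroʳ; *-assoc;
         *-distribˡ-+; neg-distrib-+; neg-distribˡ-*; neg-distribʳ-*; neg-involutive)
open import Data.Integer.Tactic.RingSolver using (solve-∀)
open import Data.List using (List; []; _∷_; length; map; _++_; concatMap; allFin; zip; lookup; filter)
open import Data.List.Properties
  using (∷-injectiveˡ; ∷-injectiveʳ; map-tabulate; map-cong-local; length-map)
open import Data.List.Membership.Propositional using (_∈_)
open import Data.List.Membership.Propositional.Properties using (∈-allFin)
open import Data.List.Relation.Unary.All as All using (All; []; _∷_)
import Data.List.Relation.Unary.All.Properties as Allₚ
open import Data.List.Relation.Unary.AllPairs using ([]; _∷_)
open import Data.List.Relation.Unary.Any using (here; there)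
open import Data.List.Relation.Unary.Unique.Propositional using (Unique)
open import Data.List.Relation.Unary.Unique.Propositional.Properties using (allFin⁺)
open import Data.Nat using (zero; suc; _∸_; _≡ᵇ_; _<ᵇ_; _≤ᵇ_; _>_)
import Data.Nat as ℕ
import Data.Nat.Properties as ℕₚ
open import Data.Nat.ListAction.Properties using (sum-++)
open import Data.List.Extrema ℕₚ.≤-totalOrder using (argmax; argmax-sel; f[⊥]≤f[argmax]; f[xs]≤f[argmax])
open import Data.Product using (proj₂)
open import Data.Sum as Sum using (_⊎_; inj₁; inj₂)
open import Data.Unit using (tt)
open import Function using (id; case_of_)
open import Function.Bundles using (Equivalence)
open import Relation.Binary.PropositionalEquality
  using (_≢_; refl; sym; trans; cong; cong₂; subst; module ≡-Reasoning)
open import Relation.Nullary using (¬_; contradiction)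
open import Relation.Nullary.Decidable
  using (Dec; yes; no; ⌊_⌋; dec-true; dec-false; isYes≗does; ⌊⌋-map′)
open import Algebra.Properties.CommutativeSemigroup
  (CommutativeMonoid.commutativeSemigroup ∧-commutativeMonoid)
  using () renaming (interchange to ∧-interchange; x∙yz≈y∙xz to ∧-rotate)

private variable A B : Set

∑ : List A → (A → ℤ) → ℤ
∑ []       f = 0ℤ
∑ (x ∷ xs) f = f x + ∑ xs f

syntax ∑ xs (λ x → e) = ∑[ x ← xs ] e

∑-cong : (xs : List A) {f g : A → ℤ} → (∀ x → f x ≡ g x) → ∑ xs f ≡ ∑ xs g
∑-cong []       e = refl
∑-cong (x ∷ xs) e = cong₂ _+_ (e x) (∑-cong xs e)

∑-congᴬ : {P : A → Set} (xs : List A) → All P xs → {f g : A → ℤ} →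
          (∀ x → P x → f x ≡ g x) → ∑ xs f ≡ ∑ xs g
∑-congᴬ []       []         e = refl
∑-congᴬ (x ∷ xs) (px ∷ pxs) e = cong₂ _+_ (e x px) (∑-congᴬ xs pxs e)

∑-zero : (xs : List A) → ∑[ x ← xs ] 0ℤ ≡ 0ℤ
∑-zero []       = refl
∑-zero (x ∷ xs) = trans (+-identityˡ _) (∑-zero xs)

∑-+ : (xs : List A) (f g : A → ℤ) → ∑[ x ← xs ] (f x + g x) ≡ ∑ xs f + ∑ xs g
∑-+ []       f g = refl
∑-+ (x ∷ xs) f g = trans (cong (λ z → (f x + g x) + z) (∑-+ xs f g)) (+-interchange (f x) (g x) _ _)
  where
  +-interchange : ∀ a b c d → (a + b) + (c + d) ≡ (a + c) + (b + d)
  +-interchange = solve-∀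

∑-*ˡ : (xs : List A) (c : ℤ) (f : A → ℤ) → ∑[ x ← xs ] (c * f x) ≡ c * ∑ xs f
∑-*ˡ []       c f = sym (*-zeroʳ c)
∑-*ˡ (x ∷ xs) c f = trans (cong (λ z → c * f x + z) (∑-*ˡ xs c f)) (sym (*-distribˡ-+ c (f x) _))

∑-neg : (xs : List A) (f : A → ℤ) → ∑[ x ← xs ] (- f x) ≡ - ∑ xs f
∑-neg []       f = refl
∑-neg (x ∷ xs) f = trans (cong (λ z → - f x + z) (∑-neg xs f)) (sym (neg-distrib-+ (f x) _))

∑-++ : (xs ys : List A) (f : A → ℤ) → ∑ (xs ++ ys) f ≡ ∑ xs f + ∑ ys f
∑-++ []       ys f = sym (+-identityˡ _)
∑-++ (x ∷ xs) ys f = trans (cong (λ z → f x + z) (∑-++ xs ys f)) (sym (+-assoc (f x) _ _))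

∑-map : (h : A → B) (xs : List A) (f : B → ℤ) → ∑ (map h xs) f ≡ ∑[ x ← xs ] f (h x)
∑-map h []       f = refl
∑-map h (x ∷ xs) f = cong (λ z → f (h x) + z) (∑-map h xs f)

∑-concatMap : (h : A → List B) (xs : List A) (f : B → ℤ) →
              ∑ (concatMap h xs) f ≡ ∑[ x ← xs ] ∑ (h x) f
∑-concatMap h []       f = refl
∑-concatMap h (x ∷ xs) f =
  trans (∑-++ (h x) (concatMap h xs) f) (cong (λ z → ∑ (h x) f + z) (∑-concatMap h xs f))

∑-swap : (xs : List A) (ys : List B) (f : A → B → ℤ) →
         ∑[ x ← xs ] ∑[ y ← ys ] f x y ≡ ∑[ y ← ys ] ∑[ x ← xs ] f x y
∑-swap []       ys f = sym (∑-zero ys)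
∑-swap (x ∷ xs) ys f =
  trans (cong (λ z → ∑ ys (f x) + z) (∑-swap xs ys f)) (sym (∑-+ ys (f x) (λ y → ∑[ x ← xs ] f x y)))

⟦_⟧ : Bool → ℤ
⟦ true  ⟧ = 1ℤ
⟦ false ⟧ = 0ℤ

⟦∧⟧ : ∀ a b → ⟦ a ∧ b ⟧ ≡ ⟦ a ⟧ * ⟦ b ⟧
⟦∧⟧ true  b = sym (*-identityˡ _)
⟦∧⟧ false b = refl

⟦not⟧ : ∀ a → ⟦ not a ⟧ ≡ 1ℤ + - ⟦ a ⟧
⟦not⟧ true  = refl
⟦not⟧ false = refl

⟦false⟧* : ∀ b z → b ≢ true → ⟦ b ⟧ * z ≡ 0ℤ
⟦false⟧* true  z b≢true = contradiction refl b≢true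
⟦false⟧* false z b≢true = refl

count-as-∑ : (p : A → Bool) (xs : List A) → + count p xs ≡ ∑[ x ← xs ] ⟦ p x ⟧
count-as-∑ p []       = refl
count-as-∑ p (x ∷ xs) with p x
... | true  = cong (λ z → 1ℤ + z) (count-as-∑ p xs)
... | false = trans (count-as-∑ p xs) (sym (+-identityˡ _))

all-map : (f : A → B) (xs : List A) {p : B → Bool} → all p (map f xs) ≡ all (λ x → p (f x)) xs
all-map f []       = refl
all-map f (x ∷ xs) = cong (_ ∧_) (all-map f xs)

all-cong : (xs : List A) {f g : A → Bool} → (∀ x → x ∈ xs → f x ≡ g x) → all f xs ≡ all g xs
all-cong []       e = refl
all-cong (x ∷ xs) e = cong₂ _∧_ (e x (here refl)) (all-cong xs (λ y y∈ → e y (there y∈)))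

all-true : (xs : List A) (f : A → Bool) → (∀ x → x ∈ xs → f x ≡ true) → all f xs ≡ true
all-true []       f e = refl
all-true (x ∷ xs) f e rewrite e x (here refl) = all-true xs f (λ y y∈ → e y (there y∈))

all-∈ : (f : A → Bool) (xs : List A) → all f xs ≡ true → ∀ x → x ∈ xs → f x ≡ true
all-∈ f (y ∷ xs) e x x∈ with f y in fy | x∈
... | true | here refl = fy
... | true | there x∈′ = all-∈ f xs e x x∈′

all-∧ : (f g : A → Bool) (xs : List A) → all (λ x → f x ∧ g x) xs ≡ all f xs ∧ all g xs
all-∧ f g []       = refl
all-∧ f g (x ∷ xs) rewrite all-∧ f g xs = ∧-interchange (f x) (g x) (all f xs) (all g xs)

all-swap : (f : A → B → Bool) (xs : List A) (ys : List B) →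
           all (λ x → all (f x) ys) xs ≡ all (λ y → all (λ x → f x y) xs) ys
all-swap f []       ys = sym (all-true ys _ (λ _ _ → refl))
all-swap f (x ∷ xs) ys rewrite all-swap f xs ys = sym (all-∧ (f x) (λ y → all (λ x → f x y) xs) ys)

count-cong : (xs : List A) {f g : A → Bool} → (∀ x → x ∈ xs → f x ≡ g x) → count f xs ≡ count g xs
count-cong []       e = refl
count-cong (x ∷ xs) e rewrite e x (here refl) | count-cong xs (λ y y∈ → e y (there y∈)) = refl

≡ᵇ-sound : ∀ {m k} → (m ≡ᵇ k) ≡ true → m ≡ k
≡ᵇ-sound {m} {k} e = ℕₚ.≡ᵇ⇒≡ m k (Equivalence.from T-≡ e)

≡ᵇ-complete : ∀ {m k} → m ≡ k → (m ≡ᵇ k) ≡ true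
≡ᵇ-complete {m} {k} e = Equivalence.to T-≡ (ℕₚ.≡⇒≡ᵇ m k e)

count-false : (xs : List A) → count (λ _ → false) xs ≡ 0
count-false []       = refl
count-false (x ∷ xs) = count-false xs

count-true : (xs : List A) → count (λ _ → true) xs ≡ length xs
count-true []       = refl
count-true (x ∷ xs) = cong suc (count-true xs)

count-pos : (p : A → Bool) (xs : List A) (x : A) → x ∈ xs → p x ≡ true → (count p xs ≡ᵇ 0) ≡ false
count-pos p (y ∷ xs) x (here refl) px rewrite px = refl
count-pos p (y ∷ xs) x (there x∈) px with p y
... | true  = refl
... | false = count-pos p xs x x∈ px

suc≟suc : ∀ {m} (x y : Fin m) → ⌊ suc x ≟ suc y ⌋ ≡ ⌊ x ≟ y ⌋
suc≟suc x y = ⌊⌋-map′ _ _ (x ≟ y)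

⌊⌋-true : {Q : Set} (q? : Dec Q) → Q → ⌊ q? ⌋ ≡ true
⌊⌋-true q? q = trans (isYes≗does q?) (dec-true q? q)

⌊⌋-false : {Q : Set} (q? : Dec Q) → ¬ Q → ⌊ q? ⌋ ≡ false
⌊⌋-false q? ¬q = trans (isYes≗does q?) (dec-false q? ¬q)

⌊⌋-sound : {Q : Set} (q? : Dec Q) → ⌊ q? ⌋ ≡ true → Q
⌊⌋-sound (yes q) _ = q

⌊⌋-⇔ : {Q Q′ : Set} (q? : Dec Q) (q′? : Dec Q′) → (Q → Q′) → (Q′ → Q) → ⌊ q? ⌋ ≡ ⌊ q′? ⌋
⌊⌋-⇔ (yes q) q′? to from = sym (⌊⌋-true q′? (to q))
⌊⌋-⇔ (no ¬q) q′? to from = sym (⌊⌋-false q′? (λ q′ → ¬q (from q′)))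

suc≤ᵇsuc : ∀ a b → (suc a ≤ᵇ suc b) ≡ (a ≤ᵇ b)
suc≤ᵇsuc zero    b = refl
suc≤ᵇsuc (suc a) b = refl

-- Subsets of a list, encoded by masks.  masks L lists all boolean lists of
-- length L; a mask t splits a list X into the selected entries sel t X and
-- the rejected ones rej t X.

masks : ℕ → List (List Bool)
masks zero    = [] ∷ []
masks (suc L) = map (true ∷_) (masks L) ++ map (false ∷_) (masks L)

sel : List Bool → List A → List A
sel _           []       = []
sel []          (x ∷ xs) = []
sel (true ∷ t)  (x ∷ xs) = x ∷ sel t xs
sel (false ∷ t) (x ∷ xs) = sel t xs

rej : List Bool → List A → List A
rej _           []       = []
rej []          (x ∷ xs) = x ∷ xs
rej (true ∷ t)  (x ∷ xs) = rej t xs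
rej (false ∷ t) (x ∷ xs) = x ∷ rej t xs

∑-masks-suc : (L : ℕ) (f : List Bool → ℤ) →
  ∑ (masks (suc L)) f ≡ ∑[ t ← masks L ] f (true ∷ t) + ∑[ t ← masks L ] f (false ∷ t)
∑-masks-suc L f = trans (∑-++ (map (true ∷_) (masks L)) _ f)
  (cong₂ _+_ (∑-map (true ∷_) (masks L) f) (∑-map (false ∷_) (masks L) f))

masks-length : (L : ℕ) → All (λ t → length t ≡ L) (masks L)
masks-length zero    = refl ∷ []
masks-length (suc L) = Allₚ.++⁺ (Allₚ.map⁺ (All.map (cong suc) (masks-length L)))
                                 (Allₚ.map⁺ (All.map (cong suc) (masks-length L)))

length-sel+rej : (t : List Bool) (X : List A) → length (sel t X) ℕ.+ length (rej t X) ≡ length X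
length-sel+rej _           []       = refl
length-sel+rej []          (x ∷ X) = refl
length-sel+rej (true ∷ t)  (x ∷ X) = cong suc (length-sel+rej t X)
length-sel+rej (false ∷ t) (x ∷ X) = trans (ℕₚ.+-suc _ _) (cong suc (length-sel+rej t X))

count-as-length : (t : List Bool) (X : List A) → length t ≡ length X → count not t ≡ length (rej t X)
count-as-length []          []      _   = refl
count-as-length (true ∷ t)  (x ∷ X) len = count-as-length t X (ℕₚ.suc-injective len)
count-as-length (false ∷ t) (x ∷ X) len = cong suc (count-as-length t X (ℕₚ.suc-injective len))

all-sel-rej : (p : A → Bool) (t : List Bool) (X : List A) → all p X ≡ all p (sel t X) ∧ all p (rej t X)
all-sel-rej p _           []       = refl
all-sel-rej p []          (x ∷ X) = refl
all-sel-rej p (true ∷ t)  (x ∷ X) rewrite all-sel-rej p t X = sym (∧-assoc (p x) _ _)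
all-sel-rej p (false ∷ t) (x ∷ X) rewrite all-sel-rej p t X = ∧-rotate (p x) (all p (sel t X)) (all p (rej t X))

∑-empty-selection : (X : List A) (h : List A → List A → ℤ) →
  ∑[ s ← masks (length X) ] (⟦ length (sel s X) ≡ᵇ 0 ⟧ * h (sel s X) (rej s X)) ≡ h [] X
∑-empty-selection []      h = trans (+-identityʳ _) (*-identityˡ _)
∑-empty-selection (x ∷ X) h = trans (∑-masks-suc (length X) _)
  (trans (cong₂ _+_ (∑-zero (masks (length X))) (∑-empty-selection X (λ D R → h D (x ∷ R))))
         (+-identityˡ _))

∑-masks-unique : (L : ℕ) (u₀ : List Bool) (c : List Bool → Bool) (g : List Bool → ℤ) →
  length u₀ ≡ L → (∀ u → length u ≡ L → c u ≡ true → u ≡ u₀) → c u₀ ≡ true →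
  ∑[ u ← masks L ] (⟦ c u ⟧ * g u) ≡ g u₀
∑-masks-unique zero [] c g _ _ c₀ rewrite c₀ = trans (+-identityʳ _) (*-identityˡ _)
∑-masks-unique (suc L) (b ∷ u₀) c g len uniq c₀ =
  trans (∑-masks-suc L _) (one-of-two b {λ b′ → ∑[ u ← masks L ] (⟦ c (b′ ∷ u) ⟧ * g (b′ ∷ u))} on off)
  where
  on : ∑[ u ← masks L ] (⟦ c (b ∷ u) ⟧ * g (b ∷ u)) ≡ g (b ∷ u₀)
  on = ∑-masks-unique L u₀ (λ u → c (b ∷ u)) (λ u → g (b ∷ u)) (ℕₚ.suc-injective len)
    (λ u lu cu → ∷-injectiveʳ (uniq (b ∷ u) (cong suc lu) cu)) c₀
  off : ∑[ u ← masks L ] (⟦ c (not b ∷ u) ⟧ * g (not b ∷ u)) ≡ 0ℤ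
  off = trans
    (∑-congᴬ (masks L) (masks-length L) (λ u lu → ⟦false⟧* (c (not b ∷ u)) _ (λ cu →
       not-¬ refl (sym (∷-injectiveˡ (uniq (not b ∷ u) (cong suc lu) cu))))))
    (∑-zero (masks L))
  one-of-two : ∀ {v} (b : Bool) {f : Bool → ℤ} → f b ≡ v → f (not b) ≡ 0ℤ → f true + f false ≡ v
  one-of-two true  fb fnb = trans (cong₂ _+_ fb fnb) (+-identityʳ _)
  one-of-two false fb fnb = trans (cong₂ _+_ fnb fb) (+-identityˡ _)

-- ∑₃ X G sums G over all ways of distributing the entries of X, in order,
-- into three blocks.  Both ways of splitting X twice by masks compute it.
∑₃ : List A → (List A → List A → List A → ℤ) → ℤ
∑₃ []      G = G [] [] []
∑₃ (x ∷ X) G = ∑₃ X (λ a b c → G (x ∷ a) b c)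
             + (∑₃ X (λ a b c → G a (x ∷ b) c) + ∑₃ X (λ a b c → G a b (x ∷ c)))

∑-split-rest : (X : List A) (G : List A → List A → List A → ℤ) →
  ∑[ t ← masks (length X) ] ∑[ t′ ← masks (length (rej t X)) ]
    G (sel t X) (sel t′ (rej t X)) (rej t′ (rej t X))
  ≡ ∑₃ X G
∑-split-rest []      G = trans (+-identityʳ _) (+-identityʳ _)
∑-split-rest (x ∷ X) G = trans (∑-masks-suc (length X) _)
  (cong₂ _+_ (∑-split-rest X (λ a b c → G (x ∷ a) b c))
    (trans (∑-cong (masks (length X)) (λ t → ∑-masks-suc (length (rej t X)) _))
      (trans (∑-+ (masks (length X)) _ _)
        (cong₂ _+_ (∑-split-rest X (λ a b c → G a (x ∷ b) c))
                   (∑-split-rest X (λ a b c → G a b (x ∷ c)))))))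

∑-split-selected : (X : List A) (G : List A → List A → List A → ℤ) →
  ∑[ u ← masks (length X) ] ∑[ s ← masks (length (sel u X)) ]
    G (sel s (sel u X)) (rej s (sel u X)) (rej u X)
  ≡ ∑₃ X G
∑-split-selected []      G = trans (+-identityʳ _) (+-identityʳ _)
∑-split-selected (x ∷ X) G = trans (∑-masks-suc (length X) _)
  (trans (cong₂ _+_
     (trans (∑-cong (masks (length X)) (λ u → ∑-masks-suc (length (sel u X)) _))
       (trans (∑-+ (masks (length X)) _ _)
         (cong₂ _+_ (∑-split-selected X (λ a b c → G (x ∷ a) b c))
                    (∑-split-selected X (λ a b c → G a (x ∷ b) c)))))
     (∑-split-selected X (λ a b c → G a b (x ∷ c))))
    (+-assoc (∑₃ X (λ a b c → G (x ∷ a) b c)) _ _))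

sel-⊆ : {x : A} (t : List Bool) (X : List A) → x ∈ sel t X → x ∈ X
sel-⊆ (true ∷ t)  (y ∷ X) (here x≡y) = here x≡y
sel-⊆ (true ∷ t)  (y ∷ X) (there x∈) = there (sel-⊆ t X x∈)
sel-⊆ (false ∷ t) (y ∷ X) x∈         = there (sel-⊆ t X x∈)

rej-⊆ : {x : A} (t : List Bool) (X : List A) → x ∈ rej t X → x ∈ X
rej-⊆ []          (y ∷ X) x∈         = x∈
rej-⊆ (true ∷ t)  (y ∷ X) x∈         = there (rej-⊆ t X x∈)
rej-⊆ (false ∷ t) (y ∷ X) (here x≡y) = here x≡y
rej-⊆ (false ∷ t) (y ∷ X) (there x∈) = there (rej-⊆ t X x∈)

unique-sel : (t : List Bool) (X : List A) → Unique X → Unique (sel t X)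
unique-sel _           []      u          = []
unique-sel []          (x ∷ X) u          = []
unique-sel (true ∷ t)  (x ∷ X) (x≢ ∷ u)  = All.tabulate (λ y∈ → All.lookup x≢ (sel-⊆ t X y∈)) ∷ unique-sel t X u
unique-sel (false ∷ t) (x ∷ X) (_ ∷ u)   = unique-sel t X u

unique-rej : (t : List Bool) (X : List A) → Unique X → Unique (rej t X)
unique-rej _           []      u          = []
unique-rej []          (x ∷ X) u          = u
unique-rej (true ∷ t)  (x ∷ X) (_ ∷ u)   = unique-rej t X u
unique-rej (false ∷ t) (x ∷ X) (x≢ ∷ u)  = All.tabulate (λ y∈ → All.lookup x≢ (rej-⊆ t X y∈)) ∷ unique-rej t X u

sel-rej-disjoint : {x : A} (t : List Bool) (X : List A) → Unique X → x ∈ sel t X → x ∈ rej t X → ⊥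
sel-rej-disjoint (true ∷ t)  (y ∷ X) (y≢ ∷ u) (here refl) x∈r = All.lookup y≢ (rej-⊆ t X x∈r) refl
sel-rej-disjoint (true ∷ t)  (y ∷ X) (_ ∷ u)  (there x∈s) x∈r = sel-rej-disjoint t X u x∈s x∈r
sel-rej-disjoint (false ∷ t) (y ∷ X) (y≢ ∷ u) x∈s (here refl) = All.lookup y≢ (sel-⊆ t X x∈s) refl
sel-rej-disjoint (false ∷ t) (y ∷ X) (_ ∷ u)  x∈s (there x∈r) = sel-rej-disjoint t X u x∈s x∈r

sel-or-rej : {x : A} (t : List Bool) (X : List A) → x ∈ X → x ∈ sel t X ⊎ x ∈ rej t X
sel-or-rej []          (y ∷ X) x∈         = inj₂ x∈
sel-or-rej (true ∷ t)  (y ∷ X) (here x≡y) = inj₁ (here x≡y)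
sel-or-rej (true ∷ t)  (y ∷ X) (there x∈) = Sum.map₁ there (sel-or-rej t X x∈)
sel-or-rej (false ∷ t) (y ∷ X) (here x≡y) = inj₂ (here x≡y)
sel-or-rej (false ∷ t) (y ∷ X) (there x∈) = Sum.map₂ there (sel-or-rej t X x∈)

sel-map-⊆ : {x : A} (I : A → Bool) (X : List A) → x ∈ sel (map I X) X → I x ≡ true
sel-map-⊆ I (y ∷ X) x∈ with I y in Iy | x∈
... | true  | here refl = Iy
... | true  | there x∈′ = sel-map-⊆ I X x∈′
... | false | x∈′       = sel-map-⊆ I X x∈′

rej-map-⊆ : {x : A} (I : A → Bool) (X : List A) → x ∈ rej (map I X) X → I x ≡ false
rej-map-⊆ I (y ∷ X) x∈ with I y in Iy | x∈
... | true  | x∈′       = rej-map-⊆ I X x∈′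
... | false | here refl = Iy
... | false | there x∈′ = rej-map-⊆ I X x∈′

sel-map-⊇ : {x : A} (I : A → Bool) (X : List A) → x ∈ X → I x ≡ true → x ∈ sel (map I X) X
sel-map-⊇ I (y ∷ X) x∈ Ix with I y in Iy | x∈
... | true  | here refl = here refl
... | true  | there x∈′ = there (sel-map-⊇ I X x∈′ Ix)
... | false | here refl = contradiction (trans (sym Iy) Ix) (λ ())
... | false | there x∈′ = sel-map-⊇ I X x∈′ Ix

rej-map-filter : (I : A → Bool) (X : List A) → rej (map I X) X ≡ filter (λ x → not (I x) Bool.≟ true) X
rej-map-filter I []      = refl
rej-map-filter I (y ∷ X) with I y
... | true  = rej-map-filter I X
... | false = cong (y ∷_) (rej-map-filter I X)

sgn : ℕ → ℤ
sgn zero    = 1ℤ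
sgn (suc n) = - sgn n

sgn-sq : ∀ i → sgn i * sgn i ≡ 1ℤ
sgn-sq zero    = refl
sgn-sq (suc i) = trans (neg-square (sgn i)) (sgn-sq i)
  where
  neg-square : ∀ x → (- x) * (- x) ≡ x * x
  neg-square = solve-∀

binom : ℕ → ℕ → ℤ
binom _       zero    = 1ℤ
binom zero    (suc k) = 0ℤ
binom (suc n) (suc k) = binom n k + binom n (suc k)

signedBinomial : (A → Bool) → List A → ℕ → ℤ
signedBinomial q E i = ∑[ s ← masks (length E) ]
  (⟦ all q (rej s E) ⟧ * (sgn (length (rej s E)) * binom (length (rej s E)) i))

signedBinomial-step : (q : A → Bool) (x : A) (E : List A) → q x ≡ true → ∀ i →
  signedBinomial q (x ∷ E) i ≡ signedBinomial q E i + ∑[ s ← masks (length E) ]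
    (⟦ all q (rej s E) ⟧ * (- sgn (length (rej s E)) * binom (suc (length (rej s E))) i))
signedBinomial-step q x E qx i = trans (∑-masks-suc (length E) _)
  (cong (λ z → signedBinomial q E i + z) (∑-cong (masks (length E)) (λ s →
    cong (λ b → ⟦ b ∧ all q (rej s E) ⟧ * (- sgn (length (rej s E)) * binom (suc (length (rej s E))) i)) qx)))

signedBinomial-zero : (q : A → Bool) (x : A) (E : List A) → q x ≡ true →
  signedBinomial q (x ∷ E) 0 ≡ 0ℤ
signedBinomial-zero q x E qx = begin
  signedBinomial q (x ∷ E) 0
    ≡⟨ signedBinomial-step q x E qx 0 ⟩
  Y + ∑[ s ← masks (length E) ] (⟦ all q (rej s E) ⟧ * (- sgn (length (rej s E)) * 1ℤ))
    ≡⟨ cong (λ z → Y + z)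
         (trans (∑-cong (masks (length E)) (λ s → negate ⟦ all q (rej s E) ⟧ (sgn (length (rej s E)))))
                (∑-neg (masks (length E)) _)) ⟩
  Y + - Y
    ≡⟨ +-inverseʳ Y ⟩
  0ℤ ∎
  where
  open ≡-Reasoning
  Y = signedBinomial q E 0
  negate : ∀ a g → a * (- g * 1ℤ) ≡ - (a * (g * 1ℤ))
  negate = solve-∀

signedBinomial-suc : (q : A → Bool) (x : A) (E : List A) → q x ≡ true → ∀ j →
  signedBinomial q (x ∷ E) (suc j) ≡ - signedBinomial q E j
signedBinomial-suc q x E qx j = begin
  signedBinomial q (x ∷ E) (suc j)
    ≡⟨ signedBinomial-step q x E qx (suc j) ⟩
  Y (suc j) + ∑[ s ← masks (length E) ] (⟦ all q (rej s E) ⟧ *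
                 (- sgn (length (rej s E)) * (binom (length (rej s E)) j + binom (length (rej s E)) (suc j))))
    ≡⟨ cong (λ z → Y (suc j) + z)
         (trans (∑-cong (masks (length E)) (λ s → pascal ⟦ all q (rej s E) ⟧ (sgn (length (rej s E)))
                          (binom (length (rej s E)) j) (binom (length (rej s E)) (suc j))))
           (trans (∑-+ (masks (length E)) _ _)
                  (cong₂ _+_ (∑-neg (masks (length E)) _) (∑-neg (masks (length E)) _)))) ⟩
  Y (suc j) + (- Y j + - Y (suc j))
    ≡⟨ cancel (Y (suc j)) (Y j) ⟩
  - Y j ∎
  where
  open ≡-Reasoning
  Y = signedBinomial q E
  pascal : ∀ a g b₁ b₂ → a * (- g * (b₁ + b₂)) ≡ - (a * (g * b₁)) + - (a * (g * b₂))
  pascal = solve-∀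
  cancel : ∀ y z → y + (- z + - y) ≡ - z
  cancel = solve-∀

signedBinomial-count : (q : A → Bool) (E : List A) (i : ℕ) →
  signedBinomial q E i ≡ sgn i * ⟦ count q E ≡ᵇ i ⟧
signedBinomial-count q []      zero    = refl
signedBinomial-count q []      (suc i) = sym (*-zeroʳ (sgn (suc i)))
signedBinomial-count q (x ∷ E) i with q x in qx
... | false = trans (∑-masks-suc (length E) _)
                (trans (cong₂ _+_ (signedBinomial-count q E i) rejecting-x-vanishes) (+-identityʳ _))
  where
  rejecting-x-vanishes : ∑[ s ← masks (length E) ] (⟦ q x ∧ all q (rej s E) ⟧ *
    (sgn (suc (length (rej s E))) * binom (suc (length (rej s E))) i)) ≡ 0ℤ
  rejecting-x-vanishes = trans (∑-cong (masks (length E)) (λ s →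
    cong (λ b → ⟦ b ∧ all q (rej s E) ⟧ * (sgn (suc (length (rej s E))) * binom (suc (length (rej s E))) i)) qx))
    (∑-zero (masks (length E)))
signedBinomial-count q (x ∷ E) zero    | true = signedBinomial-zero q x E qx
signedBinomial-count q (x ∷ E) (suc j) | true =
  trans (signedBinomial-suc q x E qx j)
    (trans (cong -_ (signedBinomial-count q E j)) (neg-distribˡ-* (sgn j) ⟦ count q E ≡ᵇ j ⟧))

range : ℕ → List ℕ
range zero    = []
range (suc N) = 0 ∷ map suc (range N)

range-< : (N : ℕ) → All (ℕ._< N) (range N)
range-< zero    = []
range-< (suc N) = ℕ.z<s ∷ Allₚ.map⁺ (All.map ℕ.s<s (range-< N))

∑-range-pick : (N m : ℕ) (v : ℕ → ℤ) →
  ∑[ j ← range N ] (⟦ m ≡ᵇ j ⟧ * v j) ≡ ⟦ m <ᵇ N ⟧ * v m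
∑-range-pick zero    m       v = refl
∑-range-pick (suc N) zero    v =
  trans (cong (λ z → 1ℤ * v 0 + z) (trans (∑-map suc (range N) _) (∑-zero (range N)))) (+-identityʳ _)
∑-range-pick (suc N) (suc m) v =
  trans (+-identityˡ _) (trans (∑-map suc (range N) _) (∑-range-pick N m (λ j → v (suc j))))

-- Summing over r < N, a term in which d = f r and m = r are imposed
-- collapses to the single term r = m.  This is how the sums over r in the
-- sieve and in the final formula are absorbed into a weight on (d, m).
rangeWeight : ℕ → (ℕ → ℕ) → (ℕ → ℤ) → ℕ → ℕ → ℤ
rangeWeight N f c d m = ⟦ (m <ᵇ N) ∧ (d ≡ᵇ f m) ⟧ * (c m * sgn m)

∑-range-collapse : (N : ℕ) (f : ℕ → ℕ) (c : ℕ → ℤ) (ts : List A) (L : A → List B)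
  (I : A → Bool) (d : A → ℕ) (J : A → B → Bool) (m : A → B → ℕ) (K : A → B → ℤ) →
  ∑[ r ← range N ] (c r * ∑[ t ← ts ] (⟦ I t ∧ (d t ≡ᵇ f r) ⟧ *
    (sgn r * ∑[ t′ ← L t ] (⟦ J t t′ ∧ (m t t′ ≡ᵇ r) ⟧ * K t t′))))
  ≡ ∑[ t ← ts ] (⟦ I t ⟧ * ∑[ t′ ← L t ] (⟦ J t t′ ⟧ * (rangeWeight N f c (d t) (m t t′) * K t t′)))
∑-range-collapse N f c ts L I d J m K =
  trans (∑-cong (range N) (λ r → sym (∑-*ˡ ts (c r) _)))
    (trans (∑-swap (range N) ts _)
      (∑-cong ts λ t → trans (∑-cong (range N) (λ r → pull-inside t r))
        (trans (∑-swap (range N) (L t) _)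
          (trans (∑-cong (L t) (λ t′ → pick t t′)) (∑-*ˡ (L t) ⟦ I t ⟧ _)))))
  where
  pull-inside : ∀ t r →
    c r * (⟦ I t ∧ (d t ≡ᵇ f r) ⟧ * (sgn r * ∑[ t′ ← L t ] (⟦ J t t′ ∧ (m t t′ ≡ᵇ r) ⟧ * K t t′)))
    ≡ ∑[ t′ ← L t ] ((c r * (⟦ I t ∧ (d t ≡ᵇ f r) ⟧ * sgn r)) * (⟦ J t t′ ∧ (m t t′ ≡ᵇ r) ⟧ * K t t′))
  pull-inside t r = trans (reassoc (c r) ⟦ I t ∧ (d t ≡ᵇ f r) ⟧ (sgn r) _)
                      (sym (∑-*ˡ (L t) (c r * (⟦ I t ∧ (d t ≡ᵇ f r) ⟧ * sgn r)) _))
    where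
    reassoc : ∀ x y z w → x * (y * (z * w)) ≡ (x * (y * z)) * w
    reassoc = solve-∀
  pick : ∀ t t′ →
    ∑[ r ← range N ] ((c r * (⟦ I t ∧ (d t ≡ᵇ f r) ⟧ * sgn r)) * (⟦ J t t′ ∧ (m t t′ ≡ᵇ r) ⟧ * K t t′))
    ≡ ⟦ I t ⟧ * (⟦ J t t′ ⟧ * (rangeWeight N f c (d t) (m t t′) * K t t′))
  pick t t′ = trans (∑-cong (range N) guard-out) (trans (∑-range-pick N (m t t′) v) collected)
    where
    v : ℕ → ℤ
    v r = ⟦ d t ≡ᵇ f r ⟧ * (⟦ I t ⟧ * (⟦ J t t′ ⟧ * ((c r * sgn r) * K t t′)))
    guard-out : ∀ r → (c r * (⟦ I t ∧ (d t ≡ᵇ f r) ⟧ * sgn r)) * (⟦ J t t′ ∧ (m t t′ ≡ᵇ r) ⟧ * K t t′)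
                    ≡ ⟦ m t t′ ≡ᵇ r ⟧ * v r
    guard-out r rewrite ⟦∧⟧ (I t) (d t ≡ᵇ f r) | ⟦∧⟧ (J t t′) (m t t′ ≡ᵇ r) =
      shuffle (c r) ⟦ I t ⟧ ⟦ d t ≡ᵇ f r ⟧ (sgn r) ⟦ J t t′ ⟧ ⟦ m t t′ ≡ᵇ r ⟧ (K t t′)
      where
      shuffle : ∀ x i e g j k K → (x * ((i * e) * g)) * ((j * k) * K) ≡ k * (e * (i * (j * ((x * g) * K))))
      shuffle = solve-∀
    collected : ⟦ m t t′ <ᵇ N ⟧ * v (m t t′) ≡ ⟦ I t ⟧ * (⟦ J t t′ ⟧ * (rangeWeight N f c (d t) (m t t′) * K t t′))
    collected = trans
      (regroup ⟦ m t t′ <ᵇ N ⟧ ⟦ d t ≡ᵇ f (m t t′) ⟧ ⟦ I t ⟧ ⟦ J t t′ ⟧ (c (m t t′) * sgn (m t t′)) (K t t′))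
      (cong (λ z → ⟦ I t ⟧ * (⟦ J t t′ ⟧ * (z * (c (m t t′) * sgn (m t t′)) * K t t′)))
            (sym (⟦∧⟧ (m t t′ <ᵇ N) (d t ≡ᵇ f (m t t′)))))
      where
      regroup : ∀ l e i j w K → l * (e * (i * (j * (w * K)))) ≡ i * (j * ((l * e) * w * K))
      regroup = solve-∀

-- The range guards of the sieve and of the final formula, in terms of the
-- total size d + m.
sieve-guard : ∀ d m j → (m <ᵇ suc j) ∧ (d ≡ᵇ suc (j ∸ m)) ≡ ((d ℕ.+ m) ≡ᵇ suc j) ∧ not (d ≡ᵇ 0)
sieve-guard zero    m       j       = trans (∧-zeroʳ _) (sym (∧-zeroʳ _))
sieve-guard (suc d) zero    j       = trans (cong (_≡ᵇ j) (sym (ℕₚ.+-identityʳ d))) (sym (∧-identityʳ _))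
sieve-guard (suc d) (suc m) zero    = cong (λ e → (e ≡ᵇ 0) ∧ true) (sym (ℕₚ.+-suc d m))
sieve-guard (suc d) (suc m) (suc j) =
  trans (sieve-guard (suc d) m j) (cong (λ e → (suc e ≡ᵇ suc (suc j)) ∧ true) (sym (ℕₚ.+-suc d m)))

final-guard : ∀ d m k → (m <ᵇ suc k) ∧ (d ≡ᵇ k ∸ m) ≡ ((d ℕ.+ m) ≡ᵇ k)
final-guard d zero    k       = cong (_≡ᵇ k) (sym (ℕₚ.+-identityʳ d))
final-guard d (suc m) zero    = cong (_≡ᵇ 0) (sym (ℕₚ.+-suc d m))
final-guard d (suc m) (suc k) = trans (final-guard d m k) (cong (_≡ᵇ suc k) (sym (ℕₚ.+-suc d m)))

∑-allFin-suc : ∀ {m} (g : Fin (suc m) → ℤ) → ∑ (allFin (suc m)) g ≡ g zero + ∑[ j ← allFin m ] g (suc j)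
∑-allFin-suc {m} g = cong (λ z → g zero + z)
  (trans (cong (λ js → ∑ js g) (sym (map-tabulate id suc))) (∑-map suc (allFin m) g))

∑-allWords-suc : (m L : ℕ) (g : List (Fin m) → ℤ) →
  ∑ (allWords m (suc L)) g ≡ ∑[ w ← allWords m L ] ∑[ j ← allFin m ] g (j ∷ w)
∑-allWords-suc m L g = trans (∑-concatMap _ (allWords m L) g)
  (∑-cong (allWords m L) (λ w → ∑-map (_∷ w) (allFin m) g))

allWords-length : (m L : ℕ) → All (λ w → length w ≡ L) (allWords m L)
allWords-length m zero    = refl ∷ []
allWords-length m (suc L) = Allₚ.concat⁺ (Allₚ.map⁺ (All.map
  (λ {w} len → Allₚ.map⁺ (All.tabulate {xs = allFin m} (λ _ → cong suc len))) (allWords-length m L)))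

merge : ∀ {m} → List Bool → List (Fin m) → List (Fin (suc m))
merge []          w       = []
merge (true ∷ t)  w       = zero ∷ merge t w
merge (false ∷ t) []      = zero ∷ merge t []
merge (false ∷ t) (u ∷ w) = suc u ∷ merge t w

-- Every word over Fin (suc m) is uniquely merge t w: t marks the zeros.
∑-allWords-merge : (m L : ℕ) (g : List (Fin (suc m)) → ℤ) →
  ∑ (allWords (suc m) L) g ≡ ∑[ t ← masks L ] ∑[ w ← allWords m (count not t) ] g (merge t w)
∑-allWords-merge m zero    g = sym (+-identityʳ (g [] + 0ℤ))
∑-allWords-merge m (suc L) g = begin
  ∑ (allWords (suc m) (suc L)) g
    ≡⟨ ∑-allWords-suc (suc m) L g ⟩
  ∑[ w ← allWords (suc m) L ] ∑[ j ← allFin (suc m) ] g (j ∷ w)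
    ≡⟨ ∑-cong (allWords (suc m) L) (λ w → ∑-allFin-suc (λ j → g (j ∷ w))) ⟩
  ∑[ w ← allWords (suc m) L ] (g (zero ∷ w) + ∑[ j ← allFin m ] g (suc j ∷ w))
    ≡⟨ ∑-+ (allWords (suc m) L) _ _ ⟩
  ∑[ w ← allWords (suc m) L ] g (zero ∷ w) + ∑[ w ← allWords (suc m) L ] ∑[ j ← allFin m ] g (suc j ∷ w)
    ≡⟨ cong₂ _+_ (∑-allWords-merge m L (λ w → g (zero ∷ w))) shifted ⟩
  ∑[ t ← masks L ] ∑[ w ← allWords m (count not t) ] g (merge (true ∷ t) w)
    + ∑[ t ← masks L ] ∑[ w ← allWords m (count not (false ∷ t)) ] g (merge (false ∷ t) w)
    ≡⟨ sym (∑-masks-suc L _) ⟩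
  ∑[ t ← masks (suc L) ] ∑[ w ← allWords m (count not t) ] g (merge t w) ∎
  where
  open ≡-Reasoning
  shifted : ∑[ w ← allWords (suc m) L ] ∑[ j ← allFin m ] g (suc j ∷ w)
          ≡ ∑[ t ← masks L ] ∑[ w ← allWords m (suc (count not t)) ] g (merge (false ∷ t) w)
  shifted = begin
    ∑[ w ← allWords (suc m) L ] ∑[ j ← allFin m ] g (suc j ∷ w)
      ≡⟨ ∑-swap (allWords (suc m) L) (allFin m) _ ⟩
    ∑[ j ← allFin m ] ∑[ w ← allWords (suc m) L ] g (suc j ∷ w)
      ≡⟨ ∑-cong (allFin m) (λ j → ∑-allWords-merge m L (λ w → g (suc j ∷ w))) ⟩
    ∑[ j ← allFin m ] ∑[ t ← masks L ] ∑[ w ← allWords m (count not t) ] g (suc j ∷ merge t w)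
      ≡⟨ ∑-swap (allFin m) (masks L) _ ⟩
    ∑[ t ← masks L ] ∑[ j ← allFin m ] ∑[ w ← allWords m (count not t) ] g (suc j ∷ merge t w)
      ≡⟨ ∑-cong (masks L) (λ t → trans (∑-swap (allFin m) (allWords m (count not t)) _)
                                       (sym (∑-allWords-suc m (count not t) _))) ⟩
    ∑[ t ← masks L ] ∑[ w ← allWords m (suc (count not t)) ] g (merge (false ∷ t) w) ∎

module _ {m : ℕ} where

  shifted : (A × Fin (suc m) → Bool) → A × Fin m → Bool
  shifted q (x , u) = q (x , suc u)

  all-zip-merge : (q : A × Fin (suc m) → Bool) (t : List Bool) (X : List A) (w : List (Fin m)) →
    length t ≡ length X → length w ≡ length (rej t X) →
    all q (zip X (merge t w)) ≡ all (λ x → q (x , zero)) (sel t X) ∧ all (shifted q) (zip (rej t X) w)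
  all-zip-merge q []          []      w       _   _   = refl
  all-zip-merge q (true ∷ t)  (x ∷ X) w       |t| |w|
    rewrite all-zip-merge q t X w (ℕₚ.suc-injective |t|) |w| =
    sym (∧-assoc (q (x , zero)) (all (λ x → q (x , zero)) (sel t X)) _)
  all-zip-merge q (false ∷ t) (x ∷ X) (u ∷ w) |t| |w|
    rewrite all-zip-merge q t X w (ℕₚ.suc-injective |t|) (ℕₚ.suc-injective |w|) =
    ∧-rotate (q (x , suc u)) (all (λ x → q (x , zero)) (sel t X)) _

  count-zip-merge : (q : A × Fin (suc m) → Bool) (t : List Bool) (X : List A) (w : List (Fin m)) →
    length t ≡ length X → length w ≡ length (rej t X) →
    count q (zip X (merge t w)) ≡ count (λ x → q (x , zero)) (sel t X) ℕ.+ count (shifted q) (zip (rej t X) w)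
  count-zip-merge q []          []      w       _   _   = refl
  count-zip-merge q (true ∷ t)  (x ∷ X) w       |t| |w| with q (x , zero)
  ... | true  = cong suc (count-zip-merge q t X w (ℕₚ.suc-injective |t|) |w|)
  ... | false = count-zip-merge q t X w (ℕₚ.suc-injective |t|) |w|
  count-zip-merge q (false ∷ t) (x ∷ X) (u ∷ w) |t| |w| with q (x , suc u)
  ... | true  = trans (cong suc (count-zip-merge q t X w (ℕₚ.suc-injective |t|) (ℕₚ.suc-injective |w|)))
                      (sym (ℕₚ.+-suc _ _))
  ... | false = count-zip-merge q t X w (ℕₚ.suc-injective |t|) (ℕₚ.suc-injective |w|)

all-zip-fst : (h : A → Bool) (xs : List A) (ys : List B) → length ys ≡ length xs →
  all (λ p → h (proj₁ p)) (zip xs ys) ≡ all h xs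
all-zip-fst h []       ys       _   = refl
all-zip-fst h (x ∷ xs) (y ∷ ys) len = cong (h x ∧_) (all-zip-fst h xs ys (ℕₚ.suc-injective len))

-- Applied to K_X it extracts, with sign (-1)^j, the sum of K_{X∖D} over the
-- sets D of j minimal elements of X (see sieve-K below).  The fuel bounds
-- the recursion depth; it only has to be at least j.
sieve : (fuel j : ℕ) → (List ℕ → ℤ) → List ℕ → ℤ
sieve _          zero    g a = g a
sieve zero       (suc j) g a = 0ℤ
sieve (suc fuel) (suc j) g a = - ∑[ r ← range (suc j) ] sieve fuel r (λ b → g (suc (j ∸ r) ∷ b)) a

sieve-local : (fuel j : ℕ) (g g′ : List ℕ → ℤ) (a a′ : List ℕ) →
  (∀ b → g (b ++ a) ≡ g′ (b ++ a′)) → sieve fuel j g a ≡ sieve fuel j g′ a′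
sieve-local _          zero    g g′ a a′ e = e []
sieve-local zero       (suc j) g g′ a a′ e = refl
sieve-local (suc fuel) (suc j) g g′ a a′ e = cong -_ (∑-cong (range (suc j)) (λ r →
  sieve-local fuel r (λ b → g (suc (j ∸ r) ∷ b)) (λ b → g′ (suc (j ∸ r) ∷ b)) a a′ (λ b → e (suc (j ∸ r) ∷ b))))

sieve-cong : (fuel j : ℕ) {g g′ : List ℕ → ℤ} (a : List ℕ) → (∀ b → g b ≡ g′ b) →
  sieve fuel j g a ≡ sieve fuel j g′ a
sieve-cong fuel j {g} {g′} a e = sieve-local fuel j g g′ a a (λ b → e (b ++ a))

sieve-linear : (fuel j : ℕ) (xs : List A) (w : A → ℤ) (h : A → List ℕ → ℤ) (a : List ℕ) →
  sieve fuel j (λ b → ∑[ x ← xs ] (w x * h x b)) a ≡ ∑[ x ← xs ] (w x * sieve fuel j (h x) a)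
sieve-linear _          zero    xs w h a = refl
sieve-linear zero       (suc j) xs w h a = sym (trans (∑-cong xs (λ x → *-zeroʳ (w x))) (∑-zero xs))
sieve-linear (suc fuel) (suc j) xs w h a =
  trans (cong -_ (trans (∑-cong (range (suc j)) (λ r → sieve-linear fuel r xs w (λ x b → h x (suc (j ∸ r) ∷ b)) a))
                 (trans (∑-swap (range (suc j)) xs _)
                        (∑-cong xs (λ x → ∑-*ˡ (range (suc j)) (w x) _)))))
        (trans (sym (∑-neg xs _)) (∑-cong xs (λ x → neg-distribʳ-* (w x) _)))

sieve-zero : (fuel j : ℕ) (a : List ℕ) → sieve fuel j (λ _ → 0ℤ) a ≡ 0ℤ
sieve-zero fuel j a = sieve-linear {A = ⊥} fuel j [] (λ _ → 0ℤ) (λ _ _ → 0ℤ) a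

extract : (k i : ℕ) → (List ℕ → ℤ) → List ℕ → ℤ
extract k i f a = sgn i * ∑[ j ← range (suc k) ] (binom j i * sieve j j (λ b → f ((k ∸ j) ∷ b)) a)

module _ {n : ℕ} (P : NatPoset n) where

  open import Data.List.Membership.DecPropositional (_≟_ {n}) using (_∈?_)

  _≼ₚ_ : Fin n → Fin n → Bool
  x ≼ₚ y = _≼_ P x y

  -- isIdealOf D R: no element of R lies below an element of D, i.e. D is an
  -- order ideal of the subposet on D ∪ R.
  isIdealOf : List (Fin n) → List (Fin n) → Bool
  isIdealOf D R = all (λ d → all (λ r → not (r ≼ₚ d)) R) D

  isIdealOf-sel-rej : (D : List (Fin n)) (t : List Bool) (R : List (Fin n)) →
    isIdealOf D R ≡ isIdealOf D (sel t R) ∧ isIdealOf D (rej t R)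
  isIdealOf-sel-rej D t R = trans (all-cong D (λ d _ → all-sel-rej (λ r → not (r ≼ₚ d)) t R))
    (all-∧ (λ d → all (λ r → not (r ≼ₚ d)) (sel t R)) (λ d → all (λ r → not (r ≼ₚ d)) (rej t R)) D)

  orderPreserving : ∀ {m} → List (Fin n × Fin m) → Bool
  orderPreserving g = all (λ p → all (λ q → not (proj₁ p ≼ₚ proj₁ q) ∨ (toℕ (proj₂ p) ≤ᵇ toℕ (proj₂ q))) g) g

  hasContent : (a : List ℕ) → List (Fin n × Fin (length a)) → Bool
  hasContent a g = all (λ j → count (λ q → ⌊ proj₂ q ≟ j ⌋) g ≡ᵇ lookup a j) (allFin (length a))

  module _ {m : ℕ} (t : List Bool) (X : List (Fin n)) (w : List (Fin m))
           (|t| : length t ≡ length X) (|w| : length w ≡ length (rej t X)) where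

    private
      g = zip X (merge t w)
      D = sel t X
      R = rej t X

    orderPreserving-merge : orderPreserving g ≡ isIdealOf D R ∧ orderPreserving (zip R w)
    orderPreserving-merge =
      trans (all-zip-merge row t X w |t| |w|)
        (cong₂ _∧_ (all-true D _ (λ x _ → all-true g _ (λ q _ → ∨-zeroʳ _)))
          (trans (all-cong (zip R w) (λ p _ → shifted-row p))
            (trans (all-∧ (λ p → all (λ d → not (proj₁ p ≼ₚ d)) D) _ (zip R w))
              (cong (_∧ orderPreserving (zip R w))
                (trans (all-zip-fst (λ r → all (λ d → not (r ≼ₚ d)) D) R w |w|)
                       (all-swap (λ r d → not (r ≼ₚ d)) R D))))))
      where
      row : Fin n × Fin (suc m) → Bool
      row p = all (λ q → not (proj₁ p ≼ₚ proj₁ q) ∨ (toℕ (proj₂ p) ≤ᵇ toℕ (proj₂ q))) g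
      -- a nonzero label forbids exactly the elements labelled zero above it
      shifted-row : (p : Fin n × Fin m) → shifted row p ≡
        all (λ d → not (proj₁ p ≼ₚ d)) D
          ∧ all (λ q → not (proj₁ p ≼ₚ proj₁ q) ∨ (toℕ (proj₂ p) ≤ᵇ toℕ (proj₂ q))) (zip R w)
      shifted-row (y , u) = trans (all-zip-merge _ t X w |t| |w|)
        (cong₂ _∧_ (all-cong D (λ d _ → ∨-identityʳ _))
                   (all-cong (zip R w) (λ q _ → cong (not (y ≼ₚ proj₁ q) ∨_) (suc≤ᵇsuc (toℕ u) (toℕ (proj₂ q))))))

  hasContent-merge : (c : ℕ) (a : List ℕ) (t : List Bool) (X : List (Fin n)) (w : List (Fin (length a))) →
    length t ≡ length X → length w ≡ length (rej t X) →
    hasContent (c ∷ a) (zip X (merge t w)) ≡ (length (sel t X) ≡ᵇ c) ∧ hasContent a (zip (rej t X) w)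
  hasContent-merge c a t X w |t| |w| = cong₂ _∧_
    (cong (_≡ᵇ c) (trans (count-zip-merge _ t X w |t| |w|)
      (trans (cong₂ ℕ._+_ (count-true (sel t X)) (count-false (zip (rej t X) w))) (ℕₚ.+-identityʳ _))))
    (trans (cong (all column) (sym (map-tabulate id suc)))
      (trans (all-map suc (allFin (length a)))
        (all-cong (allFin (length a)) (λ j _ → cong (_≡ᵇ lookup a j)
          (trans (count-zip-merge (λ q → ⌊ proj₂ q ≟ suc j ⌋) t X w |t| |w|)
                 (cong₂ ℕ._+_ (count-false (sel t X))
                              (count-cong (zip (rej t X) w) (λ p _ → suc≟suc (proj₂ p) j))))))))
    where
    column : Fin (suc (length a)) → Bool
    column j = count (λ q → ⌊ proj₂ q ≟ j ⌋) (zip X (merge t w)) ≡ᵇ lookup (c ∷ a) j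

  isPPartition-merge : (c : ℕ) (a : List ℕ) (t : List Bool) (X : List (Fin n)) (w : List (Fin (length a))) →
    (|t| : length t ≡ length X) (|w| : length w ≡ length (rej t X)) →
    isPPartition P (c ∷ a) (zip X (merge t w))
      ≡ (isIdealOf (sel t X) (rej t X) ∧ (length (sel t X) ≡ᵇ c)) ∧ isPPartition P a (zip (rej t X) w)
  isPPartition-merge c a t X w |t| |w|
    rewrite orderPreserving-merge t X w |t| |w| | hasContent-merge c a t X w |t| |w| =
    ∧-interchange (isIdealOf (sel t X) (rej t X)) _ _ _

  -- Coefficient extraction in the first variable: the elements sent to 1 by
  -- a P-partition form an ideal D of X, and the rest is a P-partition of X ∖ D.
  K-first-variable : (X : List (Fin n)) (c : ℕ) (a : List ℕ) →
    K-on P X (c ∷ a) ≡ ∑[ t ← masks (length X) ]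
      (⟦ isIdealOf (sel t X) (rej t X) ∧ (length (sel t X) ≡ᵇ c) ⟧ * K-on P (rej t X) a)
  K-first-variable X c a = begin
    K-on P X (c ∷ a)
      ≡⟨ count-as-∑ _ (allWords (suc (length a)) (length X)) ⟩
    ∑[ w ← allWords (suc (length a)) (length X) ] ⟦ isPPartition P (c ∷ a) (zip X w) ⟧
      ≡⟨ ∑-allWords-merge (length a) (length X) _ ⟩
    ∑[ t ← masks (length X) ] ∑[ w ← allWords (length a) (count not t) ]
      ⟦ isPPartition P (c ∷ a) (zip X (merge t w)) ⟧
      ≡⟨ ∑-congᴬ (masks (length X)) (masks-length (length X)) split-first ⟩
    ∑[ t ← masks (length X) ] (⟦ ideal t ⟧ * K-on P (rej t X) a) ∎
    where
    open ≡-Reasoning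
    ideal : List Bool → Bool
    ideal t = isIdealOf (sel t X) (rej t X) ∧ (length (sel t X) ≡ᵇ c)
    split-first : ∀ t → length t ≡ length X →
      ∑[ w ← allWords (length a) (count not t) ] ⟦ isPPartition P (c ∷ a) (zip X (merge t w)) ⟧
      ≡ ⟦ ideal t ⟧ * K-on P (rej t X) a
    split-first t |t| rewrite count-as-length t X |t| =
      trans (∑-congᴬ (allWords (length a) (length (rej t X))) (allWords-length _ _) (λ w |w| →
               trans (cong ⟦_⟧ (isPPartition-merge c a t X w |t| |w|)) (⟦∧⟧ (ideal t) _)))
        (trans (∑-*ˡ (allWords (length a) (length (rej t X))) ⟦ ideal t ⟧ _)
               (cong (⟦ ideal t ⟧ *_) (sym (count-as-∑ _ (allWords (length a) (length (rej t X)))))))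

  isMaximalIn : List (Fin n) → Fin n → Bool
  isMaximalIn E d = all (λ e → not (d ≼ₚ e) ∨ ⌊ d ≟ e ⌋) E

  isAntichain : List (Fin n) → Bool
  isAntichain E = all (isMaximalIn E) E

  maximal-split : (s : List Bool) (E : List (Fin n)) → Unique E →
    isIdealOf (sel s E) (rej s E) ∧ isAntichain (rej s E) ≡ all (isMaximalIn E) (rej s E)
  maximal-split s E uE = sym (begin
    all (isMaximalIn E) M
      ≡⟨ all-cong M (λ d _ → all-sel-rej (λ e → not (d ≼ₚ e) ∨ ⌊ d ≟ e ⌋) s E) ⟩
    all (λ d → isMaximalIn D d ∧ isMaximalIn M d) M
      ≡⟨ all-∧ (isMaximalIn D) (isMaximalIn M) M ⟩
    all (isMaximalIn D) M ∧ isAntichain M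
      ≡⟨ cong (_∧ isAntichain M) (all-cong M (λ r r∈M → all-cong D (λ d d∈D →
           trans (cong (not (r ≼ₚ d) ∨_) (⌊⌋-false (r ≟ d) (λ { refl → sel-rej-disjoint s E uE d∈D r∈M })))
                 (∨-identityʳ _)))) ⟩
    all (λ r → all (λ d → not (r ≼ₚ d)) D) M ∧ isAntichain M
      ≡⟨ cong (_∧ isAntichain M) (all-swap (λ r d → not (r ≼ₚ d)) M D) ⟩
    isIdealOf D M ∧ isAntichain M ∎)
    where
    open ≡-Reasoning
    D = sel s E
    M = rej s E

  -- Since P is naturally labeled, an element with the largest label is maximal.
  largest-label-maximal : (E : List (Fin n)) (d : Fin n) → All (λ e → toℕ e ℕ.≤ toℕ d) E →
    isMaximalIn E d ≡ true
  largest-label-maximal E d below = all-true E _ λ e e∈E → above-is-equal e (All.lookup below e∈E)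
    where
    above-is-equal : ∀ e → toℕ e ℕ.≤ toℕ d → not (d ≼ₚ e) ∨ ⌊ d ≟ e ⌋ ≡ true
    above-is-equal e e≤d with d ≼ₚ e in d≼e
    ... | false = refl
    ... | true  = ⌊⌋-true (d ≟ e) (toℕ-injective (ℕₚ.≤-antisym (natural P d e d≼e) e≤d))

  maximal-exists : (x : Fin n) (E : List (Fin n)) → (count (isMaximalIn (x ∷ E)) (x ∷ E) ≡ᵇ 0) ≡ false
  maximal-exists x E = count-pos (isMaximalIn (x ∷ E)) (x ∷ E) top top∈
    (largest-label-maximal (x ∷ E) top (f[⊥]≤f[argmax] {f = toℕ} x E ∷ f[xs]≤f[argmax] {f = toℕ} x E))
    where
    top = argmax toℕ x E
    top∈ : top ∈ x ∷ E
    top∈ with argmax-sel toℕ x E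
    ... | inj₁ top≡x = here top≡x
    ... | inj₂ top∈E = there top∈E

  -- minimalSum j X a = ∑ K_{X∖D}(xᵃ) over the ideals D of X that are
  -- antichains of size j, i.e. over the sets D of j minimal elements of X.
  minimalSum : ℕ → List (Fin n) → List ℕ → ℤ
  minimalSum j X a = ∑[ t ← masks (length X) ]
    (⟦ (isIdealOf (sel t X) (rej t X) ∧ isAntichain (sel t X)) ∧ (length (sel t X) ≡ᵇ j) ⟧ * K-on P (rej t X) a)

  minimalSum-zero : (X : List (Fin n)) (a : List ℕ) → minimalSum 0 X a ≡ K-on P X a
  minimalSum-zero X a =
    trans (∑-cong (masks (length X)) (λ t → guard-first (sel t X) (rej t X)))
      (trans (∑-empty-selection X (λ D R → ⟦ isIdealOf D R ∧ isAntichain D ⟧ * K-on P R a))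
             (*-identityˡ (K-on P X a)))
    where
    guard-first : ∀ D R → ⟦ (isIdealOf D R ∧ isAntichain D) ∧ (length D ≡ᵇ 0) ⟧ * K-on P R a
                        ≡ ⟦ length D ≡ᵇ 0 ⟧ * (⟦ isIdealOf D R ∧ isAntichain D ⟧ * K-on P R a)
    guard-first D R = trans (cong (_* K-on P R a) (⟦∧⟧ (isIdealOf D R ∧ isAntichain D) (length D ≡ᵇ 0)))
      (swap ⟦ isIdealOf D R ∧ isAntichain D ⟧ ⟦ length D ≡ᵇ 0 ⟧ (K-on P R a))
      where
      swap : ∀ x y z → (x * y) * z ≡ y * (x * z)
      swap = solve-∀

  ideal-then-minimal : (s : List Bool) (E R : List (Fin n)) → Unique E →
    (isIdealOf (sel s E) (rej s E) ∧ isIdealOf (sel s E) R) ∧ (isIdealOf (rej s E) R ∧ isAntichain (rej s E))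
    ≡ isIdealOf E R ∧ all (isMaximalIn E) (rej s E)
  ideal-then-minimal s E R uE =
    trans (shuffle (isIdealOf D₁ D₂) (isIdealOf D₁ R) (isIdealOf D₂ R) (isAntichain D₂))
          (cong₂ _∧_ (sym (all-sel-rej (λ d → all (λ r → not (r ≼ₚ d)) R) s E)) (maximal-split s E uE))
    where
    D₁ = sel s E
    D₂ = rej s E
    shuffle : ∀ x y z w → (x ∧ y) ∧ (z ∧ w) ≡ (y ∧ z) ∧ (x ∧ w)
    shuffle true  y z w = sym (∧-assoc y z w)
    shuffle false y z w = sym (∧-zeroʳ (y ∧ z))

  compose-ideal-minimal : (ω : ℕ → ℕ → ℤ) (a : List ℕ) (X : List (Fin n)) → Unique X →
    ∑[ t ← masks (length X) ] (⟦ isIdealOf (sel t X) (rej t X) ⟧ *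
      ∑[ t′ ← masks (length (rej t X)) ]
        (⟦ isIdealOf (sel t′ (rej t X)) (rej t′ (rej t X)) ∧ isAntichain (sel t′ (rej t X)) ⟧ *
         (ω (length (sel t X)) (length (sel t′ (rej t X))) * K-on P (rej t′ (rej t X)) a)))
    ≡ ∑[ u ← masks (length X) ] ∑[ s ← masks (length (sel u X)) ]
        (⟦ isIdealOf (sel u X) (rej u X) ∧ all (isMaximalIn (sel u X)) (rej s (sel u X)) ⟧ *
         (ω (length (sel s (sel u X))) (length (rej s (sel u X))) * K-on P (rej u X) a))
  compose-ideal-minimal ω a X uX =
    trans (∑-cong (masks (length X)) (λ t →
            trans (sym (∑-*ˡ (masks (length (rej t X))) ⟦ isIdealOf (sel t X) (rej t X) ⟧ _))
                  (∑-cong (masks (length (rej t X))) (λ t′ → split-guard (sel t X) t′ (rej t X)))))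
      (trans (∑-split-rest X G)
        (trans (sym (∑-split-selected X G))
          (∑-cong (masks (length X)) (λ u → ∑-cong (masks (length (sel u X))) (λ s →
            cong (λ b → ⟦ b ⟧ * (ω (length (sel s (sel u X))) (length (rej s (sel u X))) * K-on P (rej u X) a))
                 (ideal-then-minimal s (sel u X) (rej u X) (unique-sel u X uX)))))))
    where
    G : List (Fin n) → List (Fin n) → List (Fin n) → ℤ
    G D₁ D₂ R = ⟦ (isIdealOf D₁ D₂ ∧ isIdealOf D₁ R) ∧ (isIdealOf D₂ R ∧ isAntichain D₂) ⟧
                * (ω (length D₁) (length D₂) * K-on P R a)
    split-guard : ∀ D₁ t′ R₁ →
      ⟦ isIdealOf D₁ R₁ ⟧ * (⟦ isIdealOf (sel t′ R₁) (rej t′ R₁) ∧ isAntichain (sel t′ R₁) ⟧ *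
        (ω (length D₁) (length (sel t′ R₁)) * K-on P (rej t′ R₁) a))
      ≡ G D₁ (sel t′ R₁) (rej t′ R₁)
    split-guard D₁ t′ R₁ =
      trans (sym (*-assoc ⟦ isIdealOf D₁ R₁ ⟧ _ _))
        (cong (_* (ω (length D₁) (length (sel t′ R₁)) * K-on P (rej t′ R₁) a))
          (trans (sym (⟦∧⟧ (isIdealOf D₁ R₁) _))
                 (cong (λ b → ⟦ b ∧ (isIdealOf (sel t′ R₁) (rej t′ R₁) ∧ isAntichain (sel t′ R₁)) ⟧)
                       (isIdealOf-sel-rej D₁ t′ R₁))))

  sieve-first-variable : (fuel r c : ℕ) (X : List (Fin n)) (a : List ℕ) →
    sieve fuel r (λ b → K-on P X (c ∷ b)) a ≡ ∑[ t ← masks (length X) ]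
      (⟦ isIdealOf (sel t X) (rej t X) ∧ (length (sel t X) ≡ᵇ c) ⟧ * sieve fuel r (K-on P (rej t X)) a)
  sieve-first-variable fuel r c X a = trans (sieve-cong fuel r a (K-first-variable X c))
    (sieve-linear fuel r (masks (length X)) (λ t → ⟦ isIdealOf (sel t X) (rej t X) ∧ (length (sel t X) ≡ᵇ c) ⟧)
                  (λ t → K-on P (rej t X)) a)

  sieve-regroup : (N : ℕ) (fuel f : ℕ → ℕ) (c : ℕ → ℤ) (a : List ℕ) (X : List (Fin n)) → Unique X →
    (∀ r → r ℕ.< N → (Y : List (Fin n)) → Unique Y → sieve (fuel r) r (K-on P Y) a ≡ sgn r * minimalSum r Y a) →
    ∑[ r ← range N ] (c r * sieve (fuel r) r (λ b → K-on P X (f r ∷ b)) a)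
    ≡ ∑[ u ← masks (length X) ] ∑[ s ← masks (length (sel u X)) ]
        (⟦ isIdealOf (sel u X) (rej u X) ∧ all (isMaximalIn (sel u X)) (rej s (sel u X)) ⟧ *
         (rangeWeight N f c (length (sel s (sel u X))) (length (rej s (sel u X))) * K-on P (rej u X) a))
  sieve-regroup N fuel f c a X uX sieve-minimal =
    trans (∑-congᴬ (range N) (range-< N) (λ r r<N → cong (c r *_)
            (trans (sieve-first-variable (fuel r) r (f r) X a)
              (∑-cong (masks (length X)) (λ t →
                cong (⟦ isIdealOf (sel t X) (rej t X) ∧ (length (sel t X) ≡ᵇ f r) ⟧ *_)
                (sieve-minimal r r<N (rej t X) (unique-rej t X uX)))))))
      (trans (∑-range-collapse N f c (masks (length X)) (λ t → masks (length (rej t X)))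
                (λ t → isIdealOf (sel t X) (rej t X)) (λ t → length (sel t X))
                (λ t t′ → isIdealOf (sel t′ (rej t X)) (rej t′ (rej t X)) ∧ isAntichain (sel t′ (rej t X)))
                (λ t t′ → length (sel t′ (rej t X))) (λ t t′ → K-on P (rej t′ (rej t X)) a))
             (compose-ideal-minimal (rangeWeight N f c) a X uX))

  maximal-alternating : (E : List (Fin n)) →
    ∑[ s ← masks (length E) ] (⟦ all (isMaximalIn E) (rej s E) ⟧ * sgn (length (rej s E))
      + - (⟦ length (sel s E) ≡ᵇ 0 ⟧ * (⟦ all (isMaximalIn E) (rej s E) ⟧ * sgn (length (rej s E)))))
    ≡ ⟦ count (isMaximalIn E) E ≡ᵇ 0 ⟧ + - (⟦ isAntichain E ⟧ * sgn (length E))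
  maximal-alternating E = trans (∑-+ (masks (length E)) _ _) (cong₂ _+_ all-subsets without-E)
    where
    all-subsets : ∑[ s ← masks (length E) ] (⟦ all (isMaximalIn E) (rej s E) ⟧ * sgn (length (rej s E)))
                ≡ ⟦ count (isMaximalIn E) E ≡ᵇ 0 ⟧
    all-subsets = trans (∑-cong (masks (length E)) (λ s →
        cong (⟦ all (isMaximalIn E) (rej s E) ⟧ *_) (sym (*-identityʳ (sgn (length (rej s E)))))))
      (trans (signedBinomial-count (isMaximalIn E) E 0) (*-identityˡ _))
    without-E : ∑[ s ← masks (length E) ]
        (- (⟦ length (sel s E) ≡ᵇ 0 ⟧ * (⟦ all (isMaximalIn E) (rej s E) ⟧ * sgn (length (rej s E)))))
      ≡ - (⟦ isAntichain E ⟧ * sgn (length E))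
    without-E = trans (∑-neg (masks (length E)) _)
      (cong -_ (∑-empty-selection E (λ _ M → ⟦ all (isMaximalIn E) M ⟧ * sgn (length M))))

  -- A set E of size j + 1 has a maximal element, so only the term M = E
  -- remains, and it exists iff E is an antichain.
  nonempty-antichain : (j : ℕ) (I : Bool) (k : ℤ) (E : List (Fin n)) →
    (⟦ length E ≡ᵇ suc j ⟧ * (⟦ I ⟧ * k))
      * (⟦ count (isMaximalIn E) E ≡ᵇ 0 ⟧ + - (⟦ isAntichain E ⟧ * sgn (length E)))
    ≡ - (sgn (suc j) * (⟦ (I ∧ isAntichain E) ∧ (length E ≡ᵇ suc j) ⟧ * k))
  nonempty-antichain j I k [] = sym (cong -_ (trans (cong (λ b → sgn (suc j) * (⟦ b ⟧ * k)) (∧-zeroʳ (I ∧ true)))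
                                                     (*-zeroʳ (sgn (suc j)))))
  nonempty-antichain j I k (x ∷ E) rewrite maximal-exists x E with length E ≡ᵇ j in |E|≡ᵇj
  ... | false = sym (cong -_ (trans (cong (λ b → sgn (suc j) * (⟦ b ⟧ * k)) (∧-zeroʳ (I ∧ isAntichain (x ∷ E))))
                                     (*-zeroʳ (sgn (suc j)))))
  ... | true rewrite ℕₚ.≡ᵇ⇒≡ (length E) j (subst T (sym |E|≡ᵇj) tt)
                   | ∧-identityʳ (I ∧ isAntichain (x ∷ E)) | ⟦∧⟧ I (isAntichain (x ∷ E)) =
    regroup ⟦ I ⟧ k ⟦ isAntichain (x ∷ E) ⟧ (sgn (suc j))
    where
    regroup : ∀ i k a g → (1ℤ * (i * k)) * (0ℤ + - (a * g)) ≡ - (g * ((i * a) * k))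
    regroup = solve-∀

  sieve-step-inner : (j : ℕ) (a : List ℕ) (E R : List (Fin n)) →
    ∑[ s ← masks (length E) ] (⟦ isIdealOf E R ∧ all (isMaximalIn E) (rej s E) ⟧ *
      (rangeWeight (suc j) (λ r → suc (j ∸ r)) (λ _ → 1ℤ) (length (sel s E)) (length (rej s E)) * K-on P R a))
    ≡ - (sgn (suc j) * (⟦ (isIdealOf E R ∧ isAntichain E) ∧ (length E ≡ᵇ suc j) ⟧ * K-on P R a))
  sieve-step-inner j a E R =
    trans (∑-cong (masks (length E)) per-term)
      (trans (∑-*ˡ (masks (length E)) Kₑ _)
        (trans (cong (Kₑ *_) (maximal-alternating E))
               (nonempty-antichain j (isIdealOf E R) (K-on P R a) E)))
    where
    Kₑ = ⟦ length E ≡ᵇ suc j ⟧ * (⟦ isIdealOf E R ⟧ * K-on P R a)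
    separate : ∀ (i mx e z : Bool) g k →
      ⟦ i ∧ mx ⟧ * ((⟦ e ∧ not z ⟧ * (1ℤ * g)) * k)
      ≡ (⟦ e ⟧ * (⟦ i ⟧ * k)) * (⟦ mx ⟧ * g + - (⟦ z ⟧ * (⟦ mx ⟧ * g)))
    separate i mx e z g k rewrite ⟦∧⟧ i mx | ⟦∧⟧ e (not z) | ⟦not⟧ z = ring ⟦ i ⟧ ⟦ mx ⟧ ⟦ e ⟧ ⟦ z ⟧ g k
      where
      ring : ∀ i mx e z g k →
        (i * mx) * (((e * (1ℤ + - z)) * (1ℤ * g)) * k) ≡ (e * (i * k)) * (mx * g + - (z * (mx * g)))
      ring = solve-∀
    per-term : ∀ s →
      ⟦ isIdealOf E R ∧ all (isMaximalIn E) (rej s E) ⟧ *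
        (rangeWeight (suc j) (λ r → suc (j ∸ r)) (λ _ → 1ℤ) (length (sel s E)) (length (rej s E)) * K-on P R a)
      ≡ Kₑ * (⟦ all (isMaximalIn E) (rej s E) ⟧ * sgn (length (rej s E))
              + - (⟦ length (sel s E) ≡ᵇ 0 ⟧ * (⟦ all (isMaximalIn E) (rej s E) ⟧ * sgn (length (rej s E)))))
    per-term s =
      trans (cong (λ b → ⟦ isIdealOf E R ∧ all (isMaximalIn E) (rej s E) ⟧
                         * ((⟦ b ⟧ * (1ℤ * sgn (length (rej s E)))) * K-on P R a))
                  (trans (sieve-guard (length (sel s E)) (length (rej s E)) j)
                         (cong (λ e → (e ≡ᵇ suc j) ∧ not (length (sel s E) ≡ᵇ 0)) (length-sel+rej s E))))
            (separate (isIdealOf E R) (all (isMaximalIn E) (rej s E)) (length E ≡ᵇ suc j) (length (sel s E) ≡ᵇ 0)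
                      (sgn (length (rej s E))) (K-on P R a))

  sieve-K : (fuel j : ℕ) → j ℕ.≤ fuel → (X : List (Fin n)) → Unique X → (a : List ℕ) →
    sieve fuel j (K-on P X) a ≡ sgn j * minimalSum j X a
  sieve-K fuel zero _ X uX a = sym (trans (*-identityˡ _) (minimalSum-zero X a))
  sieve-K (suc fuel) (suc j) (ℕ.s≤s j≤fuel) X uX a = begin
    - (∑[ r ← range (suc j) ] sieve fuel r (λ b → K-on P X (suc (j ∸ r) ∷ b)) a)
      ≡⟨ cong -_ (∑-cong (range (suc j)) (λ r →
           sym (*-identityˡ (sieve fuel r (λ b → K-on P X (suc (j ∸ r) ∷ b)) a)))) ⟩
    - (∑[ r ← range (suc j) ] (1ℤ * sieve fuel r (λ b → K-on P X (suc (j ∸ r) ∷ b)) a))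
      ≡⟨ cong -_ (sieve-regroup (suc j) (λ _ → fuel) (λ r → suc (j ∸ r)) (λ _ → 1ℤ) a X uX
                   (λ r r<j+1 Y uY → sieve-K fuel r (ℕₚ.≤-trans (ℕ.s≤s⁻¹ r<j+1) j≤fuel) Y uY a)) ⟩
    - (∑[ u ← masks (length X) ] ∑[ s ← masks (length (sel u X)) ] regrouped u s)
      ≡⟨ cong -_ (∑-cong (masks (length X)) (λ u → sieve-step-inner j a (sel u X) (rej u X))) ⟩
    - (∑[ u ← masks (length X) ] (- (sgn (suc j) * antichain u)))
      ≡⟨ trans (cong -_ (∑-neg (masks (length X)) _)) (neg-involutive _) ⟩
    ∑[ u ← masks (length X) ] (sgn (suc j) * antichain u)
      ≡⟨ ∑-*ˡ (masks (length X)) (sgn (suc j)) antichain ⟩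
    sgn (suc j) * minimalSum (suc j) X a ∎
    where
    open ≡-Reasoning
    regrouped : List Bool → List Bool → ℤ
    regrouped u s = ⟦ isIdealOf (sel u X) (rej u X) ∧ all (isMaximalIn (sel u X)) (rej s (sel u X)) ⟧ *
      (rangeWeight (suc j) (λ r → suc (j ∸ r)) (λ _ → 1ℤ) (length (sel s (sel u X))) (length (rej s (sel u X)))
        * K-on P (rej u X) a)
    antichain : List Bool → ℤ
    antichain u = ⟦ (isIdealOf (sel u X) (rej u X) ∧ isAntichain (sel u X)) ∧ (length (sel u X) ≡ᵇ suc j) ⟧
                  * K-on P (rej u X) a

  extract-inner : (k i : ℕ) (a : List ℕ) (E R : List (Fin n)) →
    sgn i * ∑[ s ← masks (length E) ] (⟦ isIdealOf E R ∧ all (isMaximalIn E) (rej s E) ⟧ *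
      (rangeWeight (suc k) (k ∸_) (λ m → binom m i) (length (sel s E)) (length (rej s E)) * K-on P R a))
    ≡ ⟦ (isIdealOf E R ∧ (length E ≡ᵇ k)) ∧ (count (isMaximalIn E) E ≡ᵇ i) ⟧ * K-on P R a
  extract-inner k i a E R =
    trans (cong (sgn i *_) (trans (∑-cong (masks (length E)) per-term)
      (trans (∑-*ˡ (masks (length E)) Kₑ _) (cong (Kₑ *_) (signedBinomial-count (isMaximalIn E) E i)))))
    (collect (isIdealOf E R) (length E ≡ᵇ k) (count (isMaximalIn E) E ≡ᵇ i))
    where
    Kₑ = ⟦ length E ≡ᵇ k ⟧ * (⟦ isIdealOf E R ⟧ * K-on P R a)
    separate : ∀ (I mx : Bool) e b g k →
      ⟦ I ∧ mx ⟧ * ((e * (b * g)) * k) ≡ (e * (⟦ I ⟧ * k)) * (⟦ mx ⟧ * (g * b))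
    separate I mx e b g k rewrite ⟦∧⟧ I mx = ring ⟦ I ⟧ ⟦ mx ⟧ e b g k
      where
      ring : ∀ i mx e b g k → (i * mx) * ((e * (b * g)) * k) ≡ (e * (i * k)) * (mx * (g * b))
      ring = solve-∀
    per-term : ∀ s →
      ⟦ isIdealOf E R ∧ all (isMaximalIn E) (rej s E) ⟧ *
        (rangeWeight (suc k) (k ∸_) (λ m → binom m i) (length (sel s E)) (length (rej s E)) * K-on P R a)
      ≡ Kₑ * (⟦ all (isMaximalIn E) (rej s E) ⟧ * (sgn (length (rej s E)) * binom (length (rej s E)) i))
    per-term s =
      trans (cong (λ b → ⟦ isIdealOf E R ∧ all (isMaximalIn E) (rej s E) ⟧ *
                          ((⟦ b ⟧ * (binom (length (rej s E)) i * sgn (length (rej s E)))) * K-on P R a))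
                  (trans (final-guard (length (sel s E)) (length (rej s E)) k)
                         (cong (_≡ᵇ k) (length-sel+rej s E))))
            (separate (isIdealOf E R) (all (isMaximalIn E) (rej s E)) ⟦ length E ≡ᵇ k ⟧
                      (binom (length (rej s E)) i) (sgn (length (rej s E))) (K-on P R a))
    collect : ∀ (I e c : Bool) →
      sgn i * ((⟦ e ⟧ * (⟦ I ⟧ * K-on P R a)) * (sgn i * ⟦ c ⟧)) ≡ ⟦ (I ∧ e) ∧ c ⟧ * K-on P R a
    collect I e c rewrite ⟦∧⟧ (I ∧ e) c | ⟦∧⟧ I e =
      trans (ring (sgn i) ⟦ I ⟧ ⟦ e ⟧ ⟦ c ⟧ (K-on P R a))
            (trans (cong (_* _) (sgn-sq i)) (*-identityˡ _))
      where
      ring : ∀ s I e c K → s * ((e * (I * K)) * (s * c)) ≡ (s * s) * (((I * e) * c) * K)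
      ring = solve-∀

  extract-K : (k i : ℕ) (X : List (Fin n)) → Unique X → (a : List ℕ) →
    extract k i (K-on P X) a ≡ ∑[ u ← masks (length X) ]
      (⟦ (isIdealOf (sel u X) (rej u X) ∧ (length (sel u X) ≡ᵇ k))
         ∧ (count (isMaximalIn (sel u X)) (sel u X) ≡ᵇ i) ⟧ * K-on P (rej u X) a)
  extract-K k i X uX a =
    trans (cong (sgn i *_) (sieve-regroup (suc k) id (k ∸_) (λ j → binom j i) a X uX
                              (λ r _ Y uY → sieve-K r r ℕₚ.≤-refl Y uY a)))
      (trans (sym (∑-*ˡ (masks (length X)) (sgn i) _))
             (∑-cong (masks (length X)) (λ u → extract-inner k i a (sel u X) (rej u X))))

  selectedBy : List Bool → List (Fin n) → Subset n
  selectedBy u X x = ⌊ x ∈? sel u X ⌋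

  private
    ∈?-∷ : ∀ {x y} (S : List (Fin n)) → y ≢ x → ⌊ y ∈? x ∷ S ⌋ ≡ ⌊ y ∈? S ⌋
    ∈?-∷ S y≢x = ⌊⌋-⇔ (_ ∈? _) (_ ∈? S) (λ { (here y≡x) → contradiction y≡x y≢x ; (there y∈S) → y∈S }) there

    head-≢ : ∀ {x y} {X : List (Fin n)} → All (x ≢_) X → y ∈ X → y ≢ x
    head-≢ x≢ y∈X y≡x = All.lookup x≢ y∈X (sym y≡x)

  count-selected : (X : List (Fin n)) → Unique X → (u : List Bool) (ψ : Fin n → Bool) →
    count (λ x → selectedBy u X x ∧ ψ x) X ≡ count ψ (sel u X)
  count-selected []      _         u           ψ = refl
  count-selected (x ∷ X) _         []          ψ = count-false (x ∷ X)
  count-selected (x ∷ X) (x≢ ∷ uX) (true ∷ u)  ψ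
    rewrite ⌊⌋-true (x ∈? x ∷ sel u X) (here refl)
          | count-cong X (λ y y∈X → cong (_∧ ψ y) (∈?-∷ (sel u X) (head-≢ x≢ y∈X)))
          | count-selected X uX u ψ = refl
  count-selected (x ∷ X) (x≢ ∷ uX) (false ∷ u) ψ
    rewrite ⌊⌋-false (x ∈? sel u X) (λ x∈ → head-≢ x≢ (sel-⊆ u X x∈) refl) = count-selected X uX u ψ

  map-selected : (X : List (Fin n)) → Unique X → (u : List Bool) → length u ≡ length X →
    map (selectedBy u X) X ≡ u
  map-selected []      _         []          _   = refl
  map-selected (x ∷ X) (x≢ ∷ uX) (true ∷ u)  |u|
    rewrite ⌊⌋-true (x ∈? x ∷ sel u X) (here refl) =
    cong (true ∷_) (trans (map-cong-local (All.tabulate (λ y∈X → ∈?-∷ (sel u X) (head-≢ x≢ y∈X))))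
                          (map-selected X uX u (ℕₚ.suc-injective |u|)))
  map-selected (x ∷ X) (x≢ ∷ uX) (false ∷ u) |u|
    rewrite ⌊⌋-false (x ∈? sel u X) (λ x∈ → head-≢ x≢ (sel-⊆ u X x∈) refl) =
    cong (false ∷_) (map-selected X uX u (ℕₚ.suc-injective |u|))

  size-selected : (u : List Bool) → size (selectedBy u (allFin n)) ≡ length (sel u (allFin n))
  size-selected u =
    trans (count-cong (allFin n) (λ x _ → sym (∧-identityʳ _)))
      (trans (count-selected (allFin n) (allFin⁺ n) u (λ _ → true)) (count-true (sel u (allFin n))))

  numMaximal-selected : (u : List Bool) →
    numMaximal P (selectedBy u (allFin n)) ≡ count (isMaximalIn (sel u (allFin n))) (sel u (allFin n))
  numMaximal-selected u = trans (count-selected (allFin n) (allFin⁺ n) u maximal) (count-cong E maximal-in-E)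
    where
    E = sel u (allFin n)
    R = rej u (allFin n)
    J = selectedBy u (allFin n)
    maximal : Fin n → Bool
    maximal x = all (λ y → not (J y ∧ (y ≠ᶠ x) ∧ x ≼ₚ y)) (allFin n)
    above-in-E : ∀ x y → y ∈ E → not (J y ∧ (y ≠ᶠ x) ∧ x ≼ₚ y) ≡ not (x ≼ₚ y) ∨ ⌊ x ≟ y ⌋
    above-in-E x y y∈E rewrite ⌊⌋-true (y ∈? E) y∈E | ⌊⌋-⇔ (y ≟ x) (x ≟ y) sym sym with x ≼ₚ y | ⌊ x ≟ y ⌋
    ... | true  | true  = refl
    ... | true  | false = refl
    ... | false | b     = cong not (∧-zeroʳ (not b))
    maximal-in-E : ∀ x → x ∈ E → maximal x ≡ isMaximalIn E x
    maximal-in-E x _ = trans (all-sel-rej _ u (allFin n))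
      (trans (cong₂ _∧_ (all-cong E (λ y y∈E → above-in-E x y y∈E))
                        (all-true R _ (λ y y∈R → cong (λ b → not (b ∧ (y ≠ᶠ x) ∧ x ≼ₚ y))
                          (⌊⌋-false (y ∈? E) (λ y∈E → sel-rej-disjoint u (allFin n) (allFin⁺ n) y∈E y∈R)))))
             (∧-identityʳ _))

  ideal-selected : (u : List Bool) → isIdealOf (sel u (allFin n)) (rej u (allFin n)) ≡ true →
    IsOrderIdeal P (selectedBy u (allFin n))
  ideal-selected u ideal x y y≼x Jx with sel-or-rej u (allFin n) (∈-allFin y)
  ... | inj₁ y∈E = ⌊⌋-true (y ∈? sel u (allFin n)) y∈E
  ... | inj₂ y∈R with trans (sym (cong not y≼x)) (all-∈ _ (rej u (allFin n))
                          (all-∈ _ (sel u (allFin n)) ideal x (⌊⌋-sound (x ∈? sel u (allFin n)) Jx)) y y∈R)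
  ...   | ()

  selected-map : (I : Subset n) → ∀ x → selectedBy (map I (allFin n)) (allFin n) x ≡ I x
  selected-map I x with I x in Ix
  ... | true  = ⌊⌋-true (x ∈? _) (sel-map-⊇ I (allFin n) (∈-allFin x) Ix)
  ... | false = ⌊⌋-false (x ∈? _) (λ x∈ → case trans (sym (sel-map-⊆ I (allFin n) x∈)) Ix of λ ())

  numMaximal-cong : (J J′ : Subset n) → (∀ x → J x ≡ J′ x) → numMaximal P J ≡ numMaximal P J′
  numMaximal-cong J J′ e = count-cong (allFin n) (λ x _ → cong₂ _∧_ (e x)
    (all-cong (allFin n) (λ y _ → cong (λ b → not (b ∧ (y ≠ᶠ x) ∧ x ≼ₚ y)) (e y))))

  -- If I is the only ideal of P of size k with i maximal elements, then
  -- extract k i (K_P) = K_{P∖I}: the sum of extract-K has a single term.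
  extract-unique-ideal : (k i : ℕ) (I : Subset n) →
    IsOrderIdeal P I → size I ≡ k → numMaximal P I ≡ i →
    ((J : Subset n) → IsOrderIdeal P J → size J ≡ k → numMaximal P J ≡ i → ∀ x → J x ≡ I x) →
    ∀ a → extract k i (K P) a ≡ K-minus P I a
  extract-unique-ideal k i I ideal-I size-I max-I unique a =
    trans (extract-K k i X (allFin⁺ n) a)
      (trans (∑-masks-unique (length X) (map I X) condition (λ u → K-on P (rej u X) a)
                (length-map I X) only-I condition-I)
             (cong (λ Y → K-on P Y a) (rej-map-filter I X)))
    where
    X = allFin n
    condition : List Bool → Bool
    condition u = (isIdealOf (sel u X) (rej u X) ∧ (length (sel u X) ≡ᵇ k))
                  ∧ (count (isMaximalIn (sel u X)) (sel u X) ≡ᵇ i)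
    only-I : ∀ u → length u ≡ length X → condition u ≡ true → u ≡ map I X
    only-I u |u| holds =
      trans (sym (map-selected X (allFin⁺ n) u |u|))
        (map-cong-local (All.tabulate {xs = X} λ {x} _ → unique (selectedBy u X)
          (ideal-selected u (∧-conicalˡ _ (length (sel u X) ≡ᵇ k) (∧-conicalˡ _ _ holds)))
          (trans (size-selected u)
                 (≡ᵇ-sound (∧-conicalʳ (isIdealOf (sel u X) (rej u X)) _ (∧-conicalˡ _ _ holds))))
          (trans (numMaximal-selected u) (≡ᵇ-sound (∧-conicalʳ _ _ holds))) x))
    condition-I : condition (map I X) ≡ true
    condition-I = cong₂ _∧_ (cong₂ _∧_ ideal-of-I
        (≡ᵇ-complete (trans (sym (size-selected (map I X)))
                            (trans (count-cong X (λ x _ → selected-map I x)) size-I))))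
      (≡ᵇ-complete (trans (sym (numMaximal-selected (map I X)))
                          (trans (numMaximal-cong _ I (selected-map I)) max-I)))
      where
      ideal-of-I : isIdealOf (sel (map I X) X) (rej (map I X) X) ≡ true
      ideal-of-I = all-true _ _ λ d d∈ → all-true _ _ λ r r∈ → not-below d r (sel-map-⊆ I X d∈) (rej-map-⊆ I X r∈)
        where
        not-below : ∀ d r → I d ≡ true → I r ≡ false → not (r ≼ₚ d) ≡ true
        not-below d r Id Ir with r ≼ₚ d in r≼d
        ... | false = refl
        ... | true with trans (sym (ideal-I d r r≼d Id)) Ir
        ...   | ()

nonzeroPart-++ : (b a : List ℕ) → nonzeroPart (b ++ a) ≡ nonzeroPart b ++ nonzeroPart a
nonzeroPart-++ []          a = refl
nonzeroPart-++ (zero ∷ b)  a = nonzeroPart-++ b a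
nonzeroPart-++ (suc x ∷ b) a = cong (suc x ∷_) (nonzeroPart-++ b a)

extract-local : (k i : ℕ) (f f′ : List ℕ → ℤ) (a a′ : List ℕ) →
  (∀ b → f (b ++ a) ≡ f′ (b ++ a′)) → extract k i f a ≡ extract k i f′ a′
extract-local k i f f′ a a′ e = cong (sgn i *_) (∑-cong (range (suc k)) (λ j → cong (binom j i *_)
  (sieve-local j j (λ b → f ((k ∸ j) ∷ b)) (λ b → f′ ((k ∸ j) ∷ b)) a a′ (λ b → e ((k ∸ j) ∷ b)))))

extract-zero : (k i : ℕ) (a : List ℕ) → extract k i (λ _ → 0ℤ) a ≡ 0ℤ
extract-zero k i a = trans (cong (sgn i *_)
  (trans (∑-cong (range (suc k)) (λ j → trans (cong (binom j i *_) (sieve-zero j j a)) (*-zeroʳ (binom j i))))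
         (∑-zero (range (suc k)))))
  (*-zeroʳ (sgn i))

extract-QSym : (n k i : ℕ) → QSymN n → QSym
extract-QSym n k i (f , quasi , homogeneous) = extract k i f , quasi′ , n , bounded
  where
  quasi′ : IsQuasisym (extract k i f)
  quasi′ a a′ e = extract-local k i f f a a′ (λ b → quasi (b ++ a) (b ++ a′)
    (trans (nonzeroPart-++ b a) (trans (cong (nonzeroPart b ++_) e) (sym (nonzeroPart-++ b a′)))))
  bounded : ∀ a → degree a > n → extract k i f a ≡ + 0
  bounded a deg>n = trans (extract-local k i f (λ _ → 0ℤ) a a (λ b → homogeneous (b ++ a) (λ deg≡n →
      ℕₚ.<-irrefl (sym deg≡n) (ℕₚ.<-≤-trans deg>n (subst (degree a ℕ.≤_) (sym (sum-++ b a)) (ℕₚ.m≤n+m _ _))))))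
    (extract-zero k i a)

corollary3p3 : (n k i : ℕ) →
    Σ (QSymN n → QSym) λ F →
      (P : NatPoset n) (I : Subset n) →
      IsOrderIdeal P I → size I ≡ k → numMaximal P I ≡ i →
      ((J : Subset n) → IsOrderIdeal P J → size J ≡ k → numMaximal P J ≡ i →
        ∀ x → J x ≡ I x) →
      (h : IsQuasisym (K P) × HomogeneousOf n (K P)) →
      ∀ a → proj₁ (F (K P , h)) a ≡ K-minus P I a
corollary3p3 n k i = extract-QSym n k i , λ P I ideal size≡k maximal≡i unique _ →
  extract-unique-ideal P k i I ideal size≡k maximal≡i unique
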